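{- If $\mathsf{NP}^{dy}\subseteq\mathsf{coNP}^{dy}$, then $\mathsf{PH}^{dy}=\mathsf{NP}^{dy}\cap\mathsf{coNP}^{dy}$.
   Context: Dynamic problems. A dynamic problem is a pair $\mathcal{D}=(\mathcal{P},\mathcal{G})$ where $\mathcal{P}$ maps bit-strings (instances) to answers ($\{0,1\}$ for decision problems) and $\mathcal{G}_n$ is a directed graph on $\{0,1\}^n$ whose edges are allowed instance-updates; $\mathcal{D}_n$ is the restriction to $n$-bit instances; an instance-sequence is a directed path $(I_0,\dots,I_k)$ in $\mathcal{G}_n$. Standing assumption: instance-updates are encodable in $\Theta(\log n)$ bits. The complement of a decision dynamic problem has the same update graphs and negated answers. Bit-probe algorithms. $\mathcal{A}_n$ operates on a bit array; at step $0$ it receives $I_0$ and initializes memory by an arbitrary function of $I_0$ (uncharged); at step $t\ge1$ it receives $(I_{t-1},I_t)$ (possibly with extra input) and runs a fixed decision tree of memory-bit reads (branching) and writes; output is read from a designated region. Update time = tree depth; space = number of memory bits. $\mathsf{P}^{dy}$: decision problems solvable (correct output $\mathcal{D}(I_t)$ at every step of every instance-sequence of length $\mathrm{poly}(n)$) with update time $O(\mathrm{polylog}\,n)$ and space $O(\mathrm{poly}\,n)$. Verifiers. $\mathcal{V}_n$ gets $I_0$ at step $0$ and outputs $(x_0,y_0)$; at step $t\ge1$ gets $((I_{t-1},I_t),\pi_t)$, $\pi_t\in\{0,1\}^{\mathrm{polylog}\,n}$, outputs $(x_t,y_t)$, $x_t\in\{0,1\}$, $y_t\in\{0,1\}^{\mathrm{polylog}\,n}$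 read as integer reward. A proof-sequence is reward-maximizing if each $\pi_t$ maximizes $y_t$ given the history. $\mathcal{D}\in\mathsf{NP}^{dy}$ iff a verifier-family with update time $O(\mathrm{polylog}\,n)$ and space $O(\mathrm{poly}\,n)$ satisfies: (1) for every proof-sequence, $x_t=0$ whenever $\mathcal{D}(I_t)=0$; (2) for reward-maximizing proof-sequences, $x_t=1$ whenever $\mathcal{D}(I_t)=1$. $\mathsf{coNP}^{dy}$: same with $0$ and $1$ exchanged in both $\mathcal{D}(I_t)$ and $x_t$. Oracles. An algorithm/verifier may use an oracle for $\mathcal{D}'$ on slice $\mathcal{D}'_m$, $m\le\mathrm{BlowUp}(n)$: it feeds an initial instance then instance-updates and reads the current answer; calls cost no time and oracle memory is not counted. $(\mathcal{C}_1)^{\mathcal{C}_2}$: problems meeting the definition of $\mathcal{C}_1$ when an oracle-family for some problem in $\mathcal{C}_2$ with blow-up $O(\mathrm{poly}\,n)$ may be used. $\Sigma_1=\mathsf{NP}^{dy}$, $\Pi_1=\mathsf{coNP}^{dy}$, $\Sigma_i=(\mathsf{NP}^{dy})^{\Sigma_{i-1}}$, $\Pi_i=(\mathsf{coNP}^{dy})^{\Sigma_{i-1}}$ for $i>1$, $\mathsf{PH}^{dy}=\bigcup_{i\ge1}(\Sigma_i\cup\Pi_i)$. -}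

module Defs where

open import Data.Bool using (Bool; true; false; not; if_then_else_)
open import Data.Nat using (ℕ; zero; suc; _+_; _*_; _^_; _≤_)
open import Data.Nat.Logarithm using (⌊log₂_⌋)
open import Data.Fin using (Fin)
open import Data.Vec using (Vec; []; _∷_; lookup; _[_]≔_)
open import Data.Maybe using (Maybe; just; nothing)
open import Data.Product using (Σ; ∃; _×_; _,_)
open import Data.Sum using (_⊎_)
open import Data.Unit using (⊤; tt)
open import Relation.Binary.PropositionalEquality using (_≡_)

BitString : ℕ → Set
BitString n = Vec Bool n

Poly : (ℕ → ℕ) → Set
Poly f = ∃ λ c → ∀ n → f n ≤ c * (suc n) ^ c

PolyLog : (ℕ → ℕ) → Set
PolyLog f = ∃ λ c → ∀ n → f n ≤ c * (suc ⌊log₂ n ⌋) ^ c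

ThetaLog : (ℕ → ℕ) → Set
ThetaLog f = ∃ λ c → ∀ n → (f n ≤ c * suc ⌊log₂ n ⌋) × (⌊log₂ n ⌋ ≤ c * suc (f n))

-- The update graph G_n on {0,1}^n is given through Θ(log n)-bit encodings
-- of instance-updates: an update u ∈ {0,1}^(ulen n) applied to I either is
-- not an allowed update of I (nothing) or leads along an edge of G_n to
-- upd I u.  The edges of G_n are exactly the pairs (I , I') with
-- upd I u ≡ just I' for some u.

record DynProblem : Set where
  field
    answer   : ∀ {n} → BitString n → Bool
    ulen     : ℕ → ℕ
    ulen-Θ   : ThetaLog ulen
    upd      : ∀ {n} → BitString n → BitString (ulen n) → Maybe (BitString n)

open DynProblem public

complement : DynProblem → DynProblem
complement D = record
  { answer = λ I → not (answer D I)
  ; ulen = ulen D ; ulen-Θ = ulen-Θ D ; upd = upd D }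

-- Oracle interfaces (what a machine sees of an oracle at input size n)

record Iface : Set₁ where
  field
    OInst : Set
    olab  : ℕ
    oupd  : OInst → Vec Bool olab → Maybe OInst
    oans  : OInst → Bool

open Iface public

noOracle : ℕ → Iface
noOracle n = record { OInst = ⊤ ; olab = 0 ; oupd = λ _ _ → nothing ; oans = λ _ → false }

oracleOn : DynProblem → (ℕ → ℕ) → ℕ → Iface
oracleOn D' m n = record
  { OInst = BitString (m n)
  ; olab  = ulen D' (m n)
  ; oupd  = upd D'
  ; oans  = answer D' }

-- Bit-probe decision trees over s memory bits, with oracle calls whose
-- instance-updates are encoded by L bits.

data Tree (s L : ℕ) : Set where
  leaf : Tree s L
  -- read memory bit i; continue with first tree if 0, second if 1
  rd   : Fin s → Tree s L → Tree s L → Tree s L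
  wr   : Fin s → Bool → Tree s L → Tree s L
  -- feed instance-update v to the oracle, branch on its new answer (0 / 1)
  call : Vec Bool L → Tree s L → Tree s L → Tree s L

depth : ∀ {s L} → Tree s L → ℕ
depth leaf = 0
depth (rd i t₀ t₁) = suc (depth t₀ Data.Nat.⊔ depth t₁)
depth (wr i b t) = suc (depth t)
depth (call v t₀ t₁) = suc (depth t₀ Data.Nat.⊔ depth t₁)

exec : ∀ {s} (O : Iface) → Tree s (olab O) → Vec Bool s × OInst O → Maybe (Vec Bool s × OInst O)
exec O leaf st = just st
exec O (rd i t₀ t₁) (m , J) with lookup m i
... | false = exec O t₀ (m , J)
... | true  = exec O t₁ (m , J)
exec O (wr i b t) (m , J) = exec O t (m [ i ]≔ b , J)
exec O (call v t₀ t₁) (m , J) with oupd O J v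
... | nothing = nothing
... | just J' with oans O J'
...   | false = exec O t₀ (m , J')
...   | true  = exec O t₁ (m , J')

bitsVal : ∀ {k} → Vec Bool k → ℕ
bitsVal [] = 0
bitsVal {suc k} (b ∷ bs) = (if b then 2 ^ k else 0) + bitsVal bs

record Verifier (D : DynProblem) (O : ℕ → Iface) : Set where
  field
    space  : ℕ → ℕ
    plen   : ℕ → ℕ
    rlen   : ℕ → ℕ                       -- reward length
    time   : ℕ → ℕ                       -- update time
    init   : ∀ n → BitString n → Vec Bool (space n)      -- uncharged initialisation
    oinit  : ∀ n → BitString n → OInst (O n)
    tree   : ∀ n → BitString (ulen D n) → Vec Bool (plen n) → Tree (space n) (olab (O n))
    xpos   : ∀ n → Fin (space n)                         -- output bit x
    ypos   : ∀ n → Vec (Fin (space n)) (rlen n)          -- reward region y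

open Verifier public

module _ {D : DynProblem} {O : ℕ → Iface} (V : Verifier D O) where

  State : ℕ → Set
  State n = Vec Bool (space V n) × OInst (O n)

  stepV : ∀ {n} → BitString (ulen D n) → Vec Bool (plen V n) → State n → Maybe (State n)
  stepV {n} u π σ = exec (O n) (tree V n u π) σ

  xOut : ∀ {n} → State n → Bool
  xOut {n} (m , _) = lookup m (xpos V n)

  yOut : ∀ {n} → State n → ℕ
  yOut {n} (m , _) = bitsVal (Data.Vec.map (lookup m) (ypos V n))

  -- π maximises the reward y_t among all proofs, given the current history
  -- (which is summarised by the verifier's current state σ)
  Maximizing : ∀ {n} → BitString (ulen D n) → Vec Bool (plen V n) → State n → Set
  Maximizing u π σ = ∀ π' σ₁ σ₂ → stepV u π σ ≡ just σ₁ → stepV u π' σ ≡ just σ₂ → yOut σ₂ ≤ yOut σ₁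

  Sound : ∀ {n} → Bool → ℕ → BitString n → State n → Set
  Sound b zero I σ = answer D I ≡ b → xOut σ ≡ b
  Sound b (suc k) I σ = (answer D I ≡ b → xOut σ ≡ b)
    × (∀ u I' → upd D I u ≡ just I' → ∀ π → ∃ λ σ' → stepV u π σ ≡ just σ' × Sound b k I' σ')

  Complete : ∀ {n} → Bool → ℕ → BitString n → State n → Set
  Complete b zero I σ = answer D I ≡ not b → xOut σ ≡ not b
  Complete b (suc k) I σ = (answer D I ≡ not b → xOut σ ≡ not b)
    × (∀ u I' → upd D I u ≡ just I' → ∀ π → Maximizing u π σ →
         ∀ σ' → stepV u π σ ≡ just σ' → Complete b k I' σ')

  -- V is a valid verifier of polarity b (b = false: NP, b = true: coNP)
  ValidVerifier : Bool → Set
  ValidVerifier b =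
      PolyLog (time V) × Poly (space V) × PolyLog (plen V) × PolyLog (rlen V)
    × (∀ n u π → depth (tree V n u π) ≤ time V n)
    × (∀ n (I₀ : BitString n) (k : ℕ) →
         Sound b k I₀ (init V n I₀ , oinit V n I₀)
       × Complete b k I₀ (init V n I₀ , oinit V n I₀))

Class : Set₁
Class = DynProblem → Set

VClass : Bool → Class
VClass b D = Σ (Verifier D noOracle) λ V → ValidVerifier V b

VClassWith : Bool → Class → Class
VClassWith b C D =
  Σ DynProblem λ D' → C D' × Σ (ℕ → ℕ) λ m → Poly m ×
    Σ (Verifier D (oracleOn D' m)) λ V → ValidVerifier V b

NPdy : Class
NPdy = VClass false

coNPdy : Class
coNPdy = VClass true

-- SigmaH i = Σ_(i+1), PiH i = Π_(i+1)
SigmaH : ℕ → Class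
SigmaH zero = NPdy
SigmaH (suc i) = VClassWith false (SigmaH i)

PiH : ℕ → Class
PiH zero = coNPdy
PiH (suc i) = VClassWith true (SigmaH i)

PHdy : Class
PHdy D = ∃ λ i → SigmaH i D ⊎ PiH i D

_⊆_ : Class → Class → Set
C₁ ⊆ C₂ = ∀ D → C₁ D → C₂ D

_∩_ : Class → Class → Class
(C₁ ∩ C₂) D = C₁ D × C₂ D

_≐_ : Class → Class → Set
C₁ ≐ C₂ = (C₁ ⊆ C₂) × (C₂ ⊆ C₁)

{-# OPTIONS --safe #-}
module Submission where

-- If NP ⊆ coNP then also coNP ⊆ NP, since flipping the output bit of a verifier turns a verifier of one
-- polarity for D into one of the other polarity for the complement of D. The hierarchy then collapses
-- level by level once an NP (or coNP) verifier V with an oracle for a problem in NP ∩ coNP is replaced by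
-- one without oracle. The new verifier W runs V and answers each oracle call by running an NP verifier V₁
-- and a coNP verifier V₂ for the oracle problem on proofs that are part of W's own proof: if V₁ accepts the
-- answer is yes, if V₂ rejects it is no, and otherwise W gives up for good with the output that is never
-- wrong for its polarity. W's reward is read lexicographically: first whether W is still alive, then V's
-- reward, then the rewards of V₁ and V₂ at each call. Hence a reward-maximizing proof of W never gives up
-- and feeds reward-maximizing proofs to V, V₁ and V₂, so the oracle answers are correct and W decides what
-- V decides.

open import Defs
open import Data.Bool using (Bool; true; false; not; if_then_else_)
open import Data.Bool.Properties using (not-injective; not-involutive)
open import Data.Nat
open import Data.Nat.Properties
open import Data.Nat.Logarithm
open import Data.Nat.Solver using (module +-*-Solver)
open import Data.Fin using (Fin; zero; suc; _↑ˡ_; _↑ʳ_; combine)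
open import Data.Vec using (Vec; []; _∷_; _++_; concat; lookup; _[_]≔_; updateAt; map; tabulate; replicate; take; drop)
open import Data.Vec.Properties
  using (lookup-++ˡ; lookup-++ʳ; []≔-++-↑ˡ; []≔-++-↑ʳ; lookup-concat; lookup∘update; map-++; map-∘; map-cong;
         tabulate-∘; tabulate-cong; tabulate∘lookup)
open import Data.Maybe using (Maybe; just; nothing; maybe)
open import Data.Maybe.Properties using (just-injective)
open import Data.Product using (∃; _×_; _,_; proj₁; proj₂)
open import Data.Sum using (_⊎_; inj₁; inj₂)
open import Data.Unit using (tt)
open import Function using (_∘_)
open import Relation.Binary.PropositionalEquality
open import Relation.Nullary using (yes; no; contradiction)
open +-*-Solver using (solve; _:+_; _:*_; _:=_)

-- Polynomial and polylogarithmic bounds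

-- Poly f and PolyLog f unfold to Bounded (λ n → n) f and Bounded ⌊log₂_⌋ f.
Bounded : (ℕ → ℕ) → (ℕ → ℕ) → Set
Bounded Y f = ∃ λ c → ∀ n → f n ≤ c * suc (Y n) ^ c

module _ {Y : ℕ → ℕ} where

  a*x^e≤[a+e]*x^[a+e] : ∀ a e n → a * suc (Y n) ^ e ≤ (a + e) * suc (Y n) ^ (a + e)
  a*x^e≤[a+e]*x^[a+e] a e n = *-mono-≤ (m≤m+n a e) (^-monoʳ-≤ (suc (Y n)) (m≤n+m e a))

  bounded-const : ∀ k → Bounded Y (λ _ → k)
  bounded-const k = k , λ n → begin
    k                   ≡⟨ *-identityʳ k ⟨
    k * 1               ≤⟨ *-monoʳ-≤ k (m^n>0 (suc (Y n)) k) ⟩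
    k * suc (Y n) ^ k   ∎
    where open ≤-Reasoning

  bounded-+ : ∀ f g → Bounded Y f → Bounded Y g → Bounded Y (λ n → f n + g n)
  bounded-+ f g (c , f≤) (d , g≤) = c + d , λ n →
    let X = suc (Y n) in begin
    f n + g n                        ≤⟨ +-mono-≤ (f≤ n) (g≤ n) ⟩
    c * X ^ c + d * X ^ d            ≤⟨ +-mono-≤ (*-monoʳ-≤ c (^-monoʳ-≤ X (m≤m+n c d)))
                                                 (*-monoʳ-≤ d (^-monoʳ-≤ X (m≤n+m d c))) ⟩
    c * X ^ (c + d) + d * X ^ (c + d) ≡⟨ *-distribʳ-+ (X ^ (c + d)) c d ⟨
    (c + d) * X ^ (c + d)            ∎
    where open ≤-Reasoning

  bounded-* : ∀ f g → Bounded Y f → Bounded Y g → Bounded Y (λ n → f n * g n)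
  bounded-* f g (c , f≤) (d , g≤) = c * d + (c + d) , λ n →
    let X = suc (Y n) in begin
    f n * g n                     ≤⟨ *-mono-≤ (f≤ n) (g≤ n) ⟩
    c * X ^ c * (d * X ^ d)       ≡⟨ interchange c (X ^ c) d (X ^ d) ⟩
    c * d * (X ^ c * X ^ d)       ≡⟨ cong (c * d *_) (^-distribˡ-+-* X c d) ⟨
    c * d * X ^ (c + d)           ≤⟨ a*x^e≤[a+e]*x^[a+e] (c * d) (c + d) n ⟩
    (c * d + (c + d)) * X ^ (c * d + (c + d)) ∎
    where
    open ≤-Reasoning
    interchange : ∀ a x b y → a * x * (b * y) ≡ a * b * (x * y)
    interchange a x b y = solve 4 (λ a x b y → a :* x :* (b :* y) := a :* b :* (x :* y)) refl a x b y

  bounded-suc : ∀ f → Bounded Y f → Bounded Y (λ n → suc (f n))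
  bounded-suc f = bounded-+ (λ _ → 1) f (bounded-const 1)

^-distribʳ-* : ∀ a b e → (a * b) ^ e ≡ a ^ e * b ^ e
^-distribʳ-* a b zero = refl
^-distribʳ-* a b (suc e) = begin
  a * b * (a * b) ^ e     ≡⟨ cong (a * b *_) (^-distribʳ-* a b e) ⟩
  a * b * (a ^ e * b ^ e) ≡⟨ solve 4 (λ a b x y → a :* b :* (x :* y) := a :* x :* (b :* y)) refl a b (a ^ e) (b ^ e) ⟩
  a * a ^ e * (b * b ^ e) ∎
  where open ≡-Reasoning

n<2^n : ∀ n → n < 2 ^ n
n<2^n zero = s≤s z≤n
n<2^n (suc n) = begin-strict
  suc n           ≤⟨ n<2^n n ⟩
  2 ^ n           <⟨ m<m+n (2 ^ n) (m^n>0 2 n) ⟩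
  2 ^ n + 2 ^ n   ≡⟨ cong (2 ^ n +_) (+-identityʳ (2 ^ n)) ⟨
  2 ^ suc n       ∎
  where open ≤-Reasoning

m≤2^n⇒⌊log₂m⌋≤n : ∀ {m} n → m ≤ 2 ^ n → ⌊log₂ m ⌋ ≤ n
m≤2^n⇒⌊log₂m⌋≤n n m≤2^n = ≤-trans (⌊log₂⌋-mono-≤ m≤2^n) (≤-reflexive (⌊log₂[2^n]⌋≡n n))

⌊log₂n⌋≤n : ∀ n → ⌊log₂ n ⌋ ≤ n
⌊log₂n⌋≤n n = m≤2^n⇒⌊log₂m⌋≤n n (<⇒≤ (n<2^n n))

n<2^[1+⌊log₂n⌋] : ∀ n → n < 2 ^ suc ⌊log₂ n ⌋
n<2^[1+⌊log₂n⌋] n with n <? 2 ^ suc ⌊log₂ n ⌋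
... | yes n< = n<
... | no n≮ = contradiction (begin
  suc ⌊log₂ n ⌋                      ≡⟨ ⌊log₂[2^n]⌋≡n (suc ⌊log₂ n ⌋) ⟨
  ⌊log₂ (2 ^ suc ⌊log₂ n ⌋) ⌋        ≤⟨ ⌊log₂⌋-mono-≤ (≮⇒≥ n≮) ⟩
  ⌊log₂ n ⌋                          ∎) (n≮n ⌊log₂ n ⌋)
  where open ≤-Reasoning

polyLog⇒poly : ∀ {f} → PolyLog f → Poly f
polyLog⇒poly (c , f≤) = c , λ n → ≤-trans (f≤ n) (*-monoʳ-≤ c (^-monoˡ-≤ c (s≤s (⌊log₂n⌋≤n n))))

poly-∘ : ∀ {f m} → Poly f → Poly m → Poly (λ n → f (m n))
poly-∘ {f} {m} (c , f≤) (d , m≤) = c * suc d ^ c + d * c , λ n →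
  let X = suc n in begin
  f (m n)                        ≤⟨ f≤ (m n) ⟩
  c * suc (m n) ^ c              ≤⟨ *-monoʳ-≤ c (^-monoˡ-≤ c (+-mono-≤ (m^n>0 X d) (m≤ n))) ⟩
  c * (X ^ d + d * X ^ d) ^ c    ≡⟨ cong (c *_) (^-distribʳ-* (suc d) (X ^ d) c) ⟩
  c * (suc d ^ c * (X ^ d) ^ c)  ≡⟨ *-assoc c _ _ ⟨
  c * suc d ^ c * (X ^ d) ^ c    ≡⟨ cong (c * suc d ^ c *_) (^-*-assoc X d c) ⟩
  c * suc d ^ c * X ^ (d * c)    ≤⟨ a*x^e≤[a+e]*x^[a+e] {Y = λ n → n} (c * suc d ^ c) (d * c) n ⟩
  _                              ∎
  where open ≤-Reasoning

polyLog-∘-poly : ∀ {f m} → PolyLog f → Poly m → PolyLog (λ n → f (m n))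
polyLog-∘-poly {f} {m} (c , f≤) (d , m≤) = c * K ^ c + c , λ n →
  let L = suc ⌊log₂ n ⌋ in begin
  f (m n)                    ≤⟨ f≤ (m n) ⟩
  c * suc ⌊log₂ m n ⌋ ^ c    ≤⟨ *-monoʳ-≤ c (^-monoˡ-≤ c (log-m≤ n)) ⟩
  c * (K * L) ^ c            ≡⟨ cong (c *_) (^-distribʳ-* K L c) ⟩
  c * (K ^ c * L ^ c)        ≡⟨ *-assoc c _ _ ⟨
  c * K ^ c * L ^ c          ≤⟨ a*x^e≤[a+e]*x^[a+e] {Y = ⌊log₂_⌋} (c * K ^ c) c n ⟩
  _                          ∎
  where
  open ≤-Reasoning
  K = suc d + d
  m≤2^ : ∀ n → m n ≤ 2 ^ (d + suc ⌊log₂ n ⌋ * d)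
  m≤2^ n = begin
    m n                                   ≤⟨ m≤ n ⟩
    d * suc n ^ d                         ≤⟨ *-mono-≤ (<⇒≤ (n<2^n d)) (^-monoˡ-≤ d (n<2^[1+⌊log₂n⌋] n)) ⟩
    2 ^ d * (2 ^ suc ⌊log₂ n ⌋) ^ d       ≡⟨ cong (2 ^ d *_) (^-*-assoc 2 (suc ⌊log₂ n ⌋) d) ⟩
    2 ^ d * 2 ^ (suc ⌊log₂ n ⌋ * d)       ≡⟨ ^-distribˡ-+-* 2 d _ ⟨
    2 ^ (d + suc ⌊log₂ n ⌋ * d)           ∎
  log-m≤ : ∀ n → suc ⌊log₂ m n ⌋ ≤ K * suc ⌊log₂ n ⌋
  log-m≤ n = let L = suc ⌊log₂ n ⌋ in begin
    suc ⌊log₂ m n ⌋        ≤⟨ s≤s (m≤2^n⇒⌊log₂m⌋≤n _ (m≤2^ n)) ⟩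
    suc d + L * d          ≤⟨ +-mono-≤ (m≤m*n (suc d) L) (≤-reflexive (*-comm L d)) ⟩
    suc d * L + d * L      ≡⟨ *-distribʳ-+ L (suc d) d ⟨
    K * L                  ∎

-- Big-endian values compare lexicographically

bitsVal<2^ : ∀ {k} (xs : Vec Bool k) → bitsVal xs < 2 ^ k
bitsVal<2^ [] = s≤s z≤n
bitsVal<2^ {suc k} (b ∷ xs) = begin-strict
  (if b then 2 ^ k else 0) + bitsVal xs ≤⟨ +-monoˡ-≤ (bitsVal xs) (digit≤ b) ⟩
  2 ^ k + bitsVal xs                    <⟨ +-monoʳ-< (2 ^ k) (bitsVal<2^ xs) ⟩
  2 ^ k + 2 ^ k                         ≡⟨ cong (2 ^ k +_) (+-identityʳ (2 ^ k)) ⟨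
  2 ^ suc k                             ∎
  where
  open ≤-Reasoning
  digit≤ : ∀ b → (if b then 2 ^ k else 0) ≤ 2 ^ k
  digit≤ true = ≤-refl
  digit≤ false = z≤n

bitsVal-++ : ∀ {k n} (xs : Vec Bool k) (ys : Vec Bool n) → bitsVal (xs ++ ys) ≡ bitsVal xs * 2 ^ n + bitsVal ys
bitsVal-++ [] ys = refl
bitsVal-++ {suc k} {n} (b ∷ xs) ys = begin
  digit (k + n) + bitsVal (xs ++ ys)
    ≡⟨ cong₂ _+_ (shift b) (bitsVal-++ xs ys) ⟩
  digit k * 2 ^ n + (bitsVal xs * 2 ^ n + bitsVal ys)
    ≡⟨ +-assoc (digit k * 2 ^ n) _ _ ⟨
  digit k * 2 ^ n + bitsVal xs * 2 ^ n + bitsVal ys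
    ≡⟨ cong (_+ bitsVal ys) (*-distribʳ-+ (2 ^ n) (digit k) (bitsVal xs)) ⟨
  (digit k + bitsVal xs) * 2 ^ n + bitsVal ys ∎
  where
  open ≡-Reasoning
  digit : ℕ → ℕ
  digit e = if b then 2 ^ e else 0
  shift : ∀ c → (if c then 2 ^ (k + n) else 0) ≡ (if c then 2 ^ k else 0) * 2 ^ n
  shift true = ^-distribˡ-+-* 2 k n
  shift false = refl

bitsVal-++-≤ˡ : ∀ {k n} (xs xs' : Vec Bool k) (ys ys' : Vec Bool n) →
  bitsVal (xs' ++ ys') ≤ bitsVal (xs ++ ys) → bitsVal xs' ≤ bitsVal xs
bitsVal-++-≤ˡ {n = n} xs xs' ys ys' ≤xs++ys with bitsVal xs' ≤? bitsVal xs
... | yes xs'≤xs = xs'≤xs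
... | no xs'≰xs = contradiction (subst₂ _≤_ (bitsVal-++ xs' ys') (bitsVal-++ xs ys) ≤xs++ys) (<⇒≱ (begin-strict
  bitsVal xs * 2 ^ n + bitsVal ys   <⟨ +-monoʳ-< _ (bitsVal<2^ ys) ⟩
  bitsVal xs * 2 ^ n + 2 ^ n        ≡⟨ +-comm (bitsVal xs * 2 ^ n) (2 ^ n) ⟩
  suc (bitsVal xs) * 2 ^ n          ≤⟨ *-monoˡ-≤ (2 ^ n) (≰⇒> xs'≰xs) ⟩
  bitsVal xs' * 2 ^ n               ≤⟨ m≤m+n _ _ ⟩
  bitsVal xs' * 2 ^ n + bitsVal ys' ∎))
  where open ≤-Reasoning

bitsVal-++-≤ʳ : ∀ {k n} (xs : Vec Bool k) (ys ys' : Vec Bool n) →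
  bitsVal (xs ++ ys') ≤ bitsVal (xs ++ ys) → bitsVal ys' ≤ bitsVal ys
bitsVal-++-≤ʳ {n = n} xs ys ys' ≤xs++ys =
  +-cancelˡ-≤ (bitsVal xs * 2 ^ n) _ _ (subst₂ _≤_ (bitsVal-++ xs ys') (bitsVal-++ xs ys) ≤xs++ys)

bitsVal-∷-≤-true : ∀ {n} (b : Bool) (ys ys' : Vec Bool n) → bitsVal (true ∷ ys') ≤ bitsVal (b ∷ ys) → b ≡ true
bitsVal-∷-≤-true true ys ys' _ = refl
bitsVal-∷-≤-true false ys ys' ≤ys with bitsVal-++-≤ˡ (false ∷ []) (true ∷ []) ys ys' ≤ys
... | ()

argmax : ∀ p (f : Vec Bool p → ℕ) → ∃ λ π → ∀ π' → f π' ≤ f π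
argmax zero f = [] , λ { [] → ≤-refl }
argmax (suc p) f with argmax p (λ π → f (false ∷ π)) | argmax p (λ π → f (true ∷ π))
... | π₀ , max₀ | π₁ , max₁ with f (false ∷ π₀) ≤? f (true ∷ π₁)
...   | yes ≤₁ = true ∷ π₁ , λ { (false ∷ π) → ≤-trans (max₀ π) ≤₁ ; (true ∷ π) → max₁ π }
...   | no ≰₁ = false ∷ π₀ ,
  λ { (false ∷ π) → max₀ π ; (true ∷ π) → ≤-trans (max₁ π) (<⇒≤ (≰⇒> ≰₁)) }

module _ {D : DynProblem} {O : ℕ → Iface} (V : Verifier D O) where

  Sound∞ : ∀ {n} → Bool → BitString n → State V n → Set
  Sound∞ b I σ = ∀ k → Sound V b k I σ

  Complete∞ : ∀ {n} → Bool → BitString n → State V n → Set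
  Complete∞ b I σ = ∀ k → Complete V b k I σ

  sound-output : ∀ {n b} {I : BitString n} {σ} k → Sound V b k I σ → answer D I ≡ b → xOut V σ ≡ b
  sound-output zero sound = sound
  sound-output (suc k) sound = proj₁ sound

  complete-output : ∀ {n b} {I : BitString n} {σ} k → Complete V b k I σ → answer D I ≡ not b → xOut V σ ≡ not b
  complete-output zero complete = complete
  complete-output (suc k) complete = proj₁ complete

  sound∞-next : ∀ {n b} {I I' : BitString n} {σ σ' u π} → Sound∞ b I σ → upd D I u ≡ just I' →
    stepV V u π σ ≡ just σ' → Sound∞ b I' σ'
  sound∞-next {b = b} {I' = I'} {π = π} sound eu step≡ k with proj₂ (sound (suc k)) _ _ eu π
  ... | _ , step≡' , sound' = subst (Sound V b k I') (just-injective (trans (sym step≡') step≡)) sound'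

  sound∞-step : ∀ {n b} {I I' : BitString n} {σ u} → Sound∞ b I σ → upd D I u ≡ just I' → ∀ π →
    ∃ λ σ' → stepV V u π σ ≡ just σ' × Sound∞ b I' σ'
  sound∞-step sound eu π with proj₂ (sound 1) _ _ eu π
  ... | σ' , step≡ , _ = σ' , step≡ , sound∞-next sound eu step≡

  complete∞-step : ∀ {n b} {I I' : BitString n} {σ σ' u π} → Complete∞ b I σ → upd D I u ≡ just I' →
    Maximizing V u π σ → stepV V u π σ ≡ just σ' → Complete∞ b I' σ'
  complete∞-step complete eu max step≡ k = proj₂ (complete (suc k)) _ _ eu _ max _ step≡

  maximizing-exists : ∀ {n} u (σ : State V n) → ∃ λ π → Maximizing V u π σ
  maximizing-exists {n} u σ with argmax (plen V n) (λ π → maybe (yOut V) 0 (stepV V u π σ))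
  ... | π , max = π , λ π' σ₁ σ₂ step₁ step₂ →
    subst₂ _≤_ (cong (maybe (yOut V) 0) step₂) (cong (maybe (yOut V) 0) step₁) (max π')

  maximizing-if-reward-≥ : ∀ {n u} {σ : State V n} {π π* σ₁ σ*} → stepV V u π σ ≡ just σ₁ →
    Maximizing V u π* σ → stepV V u π* σ ≡ just σ* → yOut V σ* ≤ yOut V σ₁ → Maximizing V u π σ
  maximizing-if-reward-≥ step₁ max* step* y*≤y₁ π' σa σb stepa stepb =
    subst (λ σ → yOut V σb ≤ yOut V σ) (just-injective (trans (sym step₁) stepa))
      (≤-trans (max* π' _ σb step* stepb) y*≤y₁)

-- Read/write programs over a structured memory

data CellTree (P : Set) : Set where
  leaf : CellTree P
  rd   : P → CellTree P → CellTree P → CellTree P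
  wr   : P → Bool → CellTree P → CellTree P

cellDepth : ∀ {P} → CellTree P → ℕ
cellDepth leaf = 0
cellDepth (rd p t₀ t₁) = suc (cellDepth t₀ ⊔ cellDepth t₁)
cellDepth (wr p x t) = suc (cellDepth t)

relabel : ∀ {P Q} → (P → Q) → CellTree P → CellTree Q
relabel f leaf = leaf
relabel f (rd p t₀ t₁) = rd (f p) (relabel f t₀) (relabel f t₁)
relabel f (wr p x t) = wr (f p) x (relabel f t)

cellDepth-relabel : ∀ {P Q} (f : P → Q) t → cellDepth (relabel f t) ≡ cellDepth t
cellDepth-relabel f leaf = refl
cellDepth-relabel f (rd p t₀ t₁) =
  cong₂ (λ d₀ d₁ → suc (d₀ ⊔ d₁)) (cellDepth-relabel f t₀) (cellDepth-relabel f t₁)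
cellDepth-relabel f (wr p x t) = cong suc (cellDepth-relabel f t)

concat-[]≔ : ∀ {A : Set} {j B} (xss : Vec (Vec A B) j) k i x →
  concat xss [ combine k i ]≔ x ≡ concat (updateAt xss k (_[ i ]≔ x))
concat-[]≔ (xs ∷ xss) zero i x = []≔-++-↑ˡ xs (concat xss) i
concat-[]≔ (xs ∷ xss) (suc k) i x =
  trans ([]≔-++-↑ʳ xs (concat xss) (combine k i)) (cong (xs ++_) (concat-[]≔ xss k i x))

writeAll : ∀ {S A : Set} {B r} → (S → A) → Vec A B → Vec S r → (Fin r → Fin B) → Vec A B
writeAll val v [] f = v
writeAll val v (c ∷ cs) f = writeAll val (v [ f zero ]≔ val c) cs (f ∘ suc)

writeAll-∷ : ∀ {S A : Set} {B r} (val : S → A) x (v : Vec A B) (cs : Vec S r) (f : Fin r → Fin B) →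
  writeAll val (x ∷ v) cs (suc ∘ f) ≡ x ∷ writeAll val v cs f
writeAll-∷ val x v [] f = refl
writeAll-∷ val x v (c ∷ cs) f = writeAll-∷ val x (v [ f zero ]≔ val c) cs (f ∘ suc)

writeAll-id : ∀ {S A : Set} {B} (val : S → A) (v : Vec A B) (cs : Vec S B) → writeAll val v cs (λ i → i) ≡ map val cs
writeAll-id val [] [] = refl
writeAll-id val (x ∷ v) (c ∷ cs) =
  trans (writeAll-∷ val (val c) v cs (λ i → i)) (cong (val c ∷_) (writeAll-id val v cs))

-- The memory of the oracle-free verifier: the memory of V, those of V₁ and V₂, an alive bit and one slot
-- per answered oracle call recording the rewards of V₁ and V₂.
module Layout (sV s₁ s₂ B : ℕ) where

  record Mem (j : ℕ) : Set where
    constructor mem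
    field
      main  : Vec Bool sV
      mem₁  : Vec Bool s₁
      mem₂  : Vec Bool s₂
      alive : Bool
      slots : Vec (Vec Bool B) j
  open Mem public

  data Region : ℕ → Set where
    mainRegion : Region sV
    region₁    : Region s₁
    region₂    : Region s₂

  data Cell (j : ℕ) : Set where
    regionCell : ∀ {s} → Region s → Fin s → Cell j
    aliveCell  : Cell j
    slotCell   : Fin j → Fin B → Cell j

  view : ∀ {j s} → Region s → Mem j → Vec Bool s
  view mainRegion = main
  view region₁ = mem₁
  view region₂ = mem₂

  replace : ∀ {j s} → Region s → Vec Bool s → Mem j → Mem j
  replace mainRegion v M = record M { main = v }
  replace region₁ v M = record M { mem₁ = v }
  replace region₂ v M = record M { mem₂ = v }

  replace-view : ∀ {j s} (R : Region s) (M : Mem j) → replace R (view R M) M ≡ M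
  replace-view mainRegion M = refl
  replace-view region₁ M = refl
  replace-view region₂ M = refl

  view-replace : ∀ {j s} (R : Region s) v (M : Mem j) → view R (replace R v M) ≡ v
  view-replace mainRegion v M = refl
  view-replace region₁ v M = refl
  view-replace region₂ v M = refl

  replace-replace : ∀ {j s} (R : Region s) v w (M : Mem j) → replace R w (replace R v M) ≡ replace R w M
  replace-replace mainRegion v w M = refl
  replace-replace region₁ v w M = refl
  replace-replace region₂ v w M = refl

  get : ∀ {j} → Mem j → Cell j → Bool
  get M (regionCell R i) = lookup (view R M) i
  get M aliveCell = alive M
  get M (slotCell k i) = lookup (lookup (slots M) k) i

  set : ∀ {j} → Mem j → Cell j → Bool → Mem j
  set M (regionCell R i) x = replace R (view R M [ i ]≔ x) M
  set M aliveCell x = record M { alive = x }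
  set M (slotCell k i) x = record M { slots = updateAt (slots M) k (_[ i ]≔ x) }

  run : ∀ {j} → CellTree (Cell j) → Mem j → Mem j
  run leaf M = M
  run (rd p t₀ t₁) M = if get M p then run t₁ M else run t₀ M
  run (wr p x t) M = run t (set M p x)

  size : ℕ → ℕ
  size j = sV + (s₁ + (s₂ + suc (j * B)))

  encode : ∀ {j} → Mem j → Vec Bool (size j)
  encode M = main M ++ (mem₁ M ++ (mem₂ M ++ (alive M ∷ concat (slots M))))

  address : ∀ {j} → Cell j → Fin (size j)
  address (regionCell mainRegion i) = i ↑ˡ _
  address (regionCell region₁ i) = sV ↑ʳ (i ↑ˡ _)
  address (regionCell region₂ i) = sV ↑ʳ (s₁ ↑ʳ (i ↑ˡ _))
  address aliveCell = sV ↑ʳ (s₁ ↑ʳ (s₂ ↑ʳ zero))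
  address (slotCell k i) = sV ↑ʳ (s₁ ↑ʳ (s₂ ↑ʳ suc (combine k i)))

  lookup-encode : ∀ {j} (M : Mem j) p → lookup (encode M) (address p) ≡ get M p
  lookup-encode (mem a c d e f) (regionCell mainRegion i) = lookup-++ˡ a _ i
  lookup-encode (mem a c d e f) (regionCell region₁ i) = trans (lookup-++ʳ a _ _) (lookup-++ˡ c _ i)
  lookup-encode (mem a c d e f) (regionCell region₂ i) =
    trans (lookup-++ʳ a _ _) (trans (lookup-++ʳ c _ _) (lookup-++ˡ d _ i))
  lookup-encode (mem a c d e f) aliveCell =
    trans (lookup-++ʳ a _ _) (trans (lookup-++ʳ c _ _) (lookup-++ʳ d _ _))
  lookup-encode (mem a c d e f) (slotCell k i) =
    trans (lookup-++ʳ a _ _) (trans (lookup-++ʳ c _ _) (trans (lookup-++ʳ d _ _) (lookup-concat f k i)))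

  update-encode : ∀ {j} (M : Mem j) p x → encode M [ address p ]≔ x ≡ encode (set M p x)
  update-encode (mem a c d e f) (regionCell mainRegion i) x = []≔-++-↑ˡ a _ i
  update-encode (mem a c d e f) (regionCell region₁ i) x = trans ([]≔-++-↑ʳ a _ _) (cong (a ++_) ([]≔-++-↑ˡ c _ i))
  update-encode (mem a c d e f) (regionCell region₂ i) x =
    trans ([]≔-++-↑ʳ a _ _) (cong (a ++_) (trans ([]≔-++-↑ʳ c _ _) (cong (c ++_) ([]≔-++-↑ˡ d _ i))))
  update-encode (mem a c d e f) aliveCell x =
    trans ([]≔-++-↑ʳ a _ _) (cong (a ++_) (trans ([]≔-++-↑ʳ c _ _) (cong (c ++_) ([]≔-++-↑ʳ d _ _))))
  update-encode (mem a c d e f) (slotCell k i) x =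
    trans ([]≔-++-↑ʳ a _ _) (cong (a ++_) (trans ([]≔-++-↑ʳ c _ _) (cong (c ++_)
      (trans ([]≔-++-↑ʳ d _ _) (cong (λ s → d ++ (e ∷ s)) (concat-[]≔ f k i x))))))

  map-lookup-encode : ∀ {j r} (M : Mem j) (cs : Vec (Cell j) r) → map (lookup (encode M)) (map address cs) ≡ map (get M) cs
  map-lookup-encode M cs = trans (sym (map-∘ (lookup (encode M)) address cs)) (map-cong (lookup-encode M) cs)

  slotAddresses : ∀ {j} → Vec (Fin (size j)) (j * B)
  slotAddresses = tabulate (λ i → sV ↑ʳ (s₁ ↑ʳ (s₂ ↑ʳ suc i)))

  map-lookup-slotAddresses : ∀ {j} (M : Mem j) → map (lookup (encode M)) (slotAddresses {j}) ≡ concat (slots M)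
  map-lookup-slotAddresses {j} M = begin
    map (lookup (encode M)) (slotAddresses {j})                 ≡⟨ tabulate-∘ (lookup (encode M)) _ ⟨
    tabulate (λ i → lookup (encode M) (sV ↑ʳ (s₁ ↑ʳ (s₂ ↑ʳ suc i))))
      ≡⟨ tabulate-cong (λ i → trans (lookup-++ʳ (main M) _ _)
                                (trans (lookup-++ʳ (mem₁ M) _ _) (lookup-++ʳ (mem₂ M) _ _))) ⟩
    tabulate (lookup (concat (slots M)))                   ≡⟨ tabulate∘lookup (concat (slots M)) ⟩
    concat (slots M)                                       ∎
    where open ≡-Reasoning

  compile : ∀ {j L} → CellTree (Cell j) → Tree (size j) L
  compile leaf = leaf
  compile (rd p t₀ t₁) = rd (address p) (compile t₀) (compile t₁)
  compile (wr p x t) = wr (address p) x (compile t)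

  depth-compile : ∀ {j L} (t : CellTree (Cell j)) → depth {L = L} (compile t) ≡ cellDepth t
  depth-compile leaf = refl
  depth-compile (rd p t₀ t₁) = cong₂ (λ d₀ d₁ → suc (d₀ ⊔ d₁)) (depth-compile t₀) (depth-compile t₁)
  depth-compile (wr p x t) = cong suc (depth-compile t)

  exec-compile : ∀ {j} n (t : CellTree (Cell j)) (M : Mem j) →
    exec (noOracle n) (compile t) (encode M , tt) ≡ just (encode (run t M) , tt)
  exec-compile n leaf M = refl
  exec-compile n (rd p t₀ t₁) M rewrite lookup-encode M p with get M p
  ... | false = exec-compile n t₀ M
  ... | true = exec-compile n t₁ M
  exec-compile n (wr p x t) M rewrite update-encode M p x = exec-compile n t (set M p x)

  embed : ∀ {j s} → Region s → Tree s 0 → CellTree (Cell j) → CellTree (Cell j)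
  embed R leaf k = k
  embed R (rd i t₀ t₁) k = rd (regionCell R i) (embed R t₀ k) (embed R t₁ k)
  embed R (wr i x t) k = wr (regionCell R i) x (embed R t k)
  embed R (call v t₀ t₁) k = leaf

  run-embed : ∀ {j s} n (R : Region s) (t : Tree s 0) (k : CellTree (Cell j)) (M : Mem j) σ →
    exec (noOracle n) t (view R M , tt) ≡ just σ → run (embed R t k) M ≡ run k (replace R (proj₁ σ) M)
  run-embed n R leaf k M σ refl = cong (run k) (sym (replace-view R M))
  run-embed n R (rd i t₀ t₁) k M σ ex with lookup (view R M) i
  ... | false = run-embed n R t₀ k M σ ex
  ... | true = run-embed n R t₁ k M σ ex
  run-embed n R (wr i x t) k M σ ex = trans
    (run-embed n R t k M' σ (subst (λ v → exec (noOracle n) t (v , tt) ≡ just σ) (sym (view-replace R _ M)) ex))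
    (cong (run k) (replace-replace R _ (proj₁ σ) M))
    where M' = replace R (view R M [ i ]≔ x) M

  cellDepth-embed : ∀ {j s} (R : Region s) (t : Tree s 0) (k : CellTree (Cell j)) →
    cellDepth (embed R t k) ≤ depth t + cellDepth k
  cellDepth-embed R leaf k = ≤-refl
  cellDepth-embed R (rd i t₀ t₁) k = s≤s (⊔-lub
    (≤-trans (cellDepth-embed R t₀ k) (+-monoˡ-≤ (cellDepth k) (m≤m⊔n (depth t₀) (depth t₁))))
    (≤-trans (cellDepth-embed R t₁ k) (+-monoˡ-≤ (cellDepth k) (m≤n⊔m (depth t₀) (depth t₁)))))
  cellDepth-embed R (wr i x t) k = s≤s (cellDepth-embed R t k)
  cellDepth-embed R (call v t₀ t₁) k = z≤n

  liftCell : ∀ {j} → Cell j → Cell (suc j)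
  liftCell (regionCell R i) = regionCell R i
  liftCell aliveCell = aliveCell
  liftCell (slotCell k i) = slotCell (suc k) i

  push : ∀ {j} → Vec Bool B → Mem j → Mem (suc j)
  push w M = mem (main M) (mem₁ M) (mem₂ M) (alive M) (w ∷ slots M)

  get-liftCell : ∀ {j} w (M : Mem j) p → get (push w M) (liftCell p) ≡ get M p
  get-liftCell w M (regionCell mainRegion i) = refl
  get-liftCell w M (regionCell region₁ i) = refl
  get-liftCell w M (regionCell region₂ i) = refl
  get-liftCell w M aliveCell = refl
  get-liftCell w M (slotCell k i) = refl

  set-liftCell : ∀ {j} w (M : Mem j) p x → set (push w M) (liftCell p) x ≡ push w (set M p x)
  set-liftCell w M (regionCell mainRegion i) x = refl
  set-liftCell w M (regionCell region₁ i) x = refl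
  set-liftCell w M (regionCell region₂ i) x = refl
  set-liftCell w M aliveCell x = refl
  set-liftCell w M (slotCell k i) x = refl

  run-liftCell : ∀ {j} (t : CellTree (Cell j)) w (M : Mem j) → run (relabel liftCell t) (push w M) ≡ push w (run t M)
  run-liftCell leaf w M = refl
  run-liftCell (rd p t₀ t₁) w M rewrite get-liftCell w M p with get M p
  ... | false = run-liftCell t₀ w M
  ... | true = run-liftCell t₁ w M
  run-liftCell (wr p x t) w M rewrite set-liftCell w M p x = run-liftCell t w (set M p x)

  copy : ∀ {j r} → Vec (Cell j) r → (Fin r → Fin B) → CellTree (Cell (suc j)) → CellTree (Cell (suc j))
  copy [] f k = k
  copy (c ∷ cs) f k = rd (liftCell c) (wr (slotCell zero (f zero)) false (copy cs (f ∘ suc) k))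
                                      (wr (slotCell zero (f zero)) true (copy cs (f ∘ suc) k))

  run-copy : ∀ {j r} (cs : Vec (Cell j) r) f (k : CellTree (Cell (suc j))) w (M : Mem j) →
    run (copy cs f k) (push w M) ≡ run k (push (writeAll (get M) w cs f) M)
  run-copy [] f k w M = refl
  run-copy (c ∷ cs) f k w M rewrite get-liftCell w M c with get M c
  ... | false = run-copy cs (f ∘ suc) k _ M
  ... | true = run-copy cs (f ∘ suc) k _ M

  cellDepth-copy : ∀ {j r} (cs : Vec (Cell j) r) f (k : CellTree (Cell (suc j))) →
    cellDepth (copy cs f k) ≡ r * 2 + cellDepth k
  cellDepth-copy [] f k = refl
  cellDepth-copy (c ∷ cs) f k =
    cong suc (trans (⊔-idem (suc (cellDepth (copy cs (f ∘ suc) k)))) (cong suc (cellDepth-copy cs (f ∘ suc) k)))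

-- Negating the output of a verifier

module Negation (D : DynProblem) (answer' : ∀ {n} → BitString n → Bool)
  (answer'≡not : ∀ {n} (I : BitString n) → answer' I ≡ not (answer D I))
  (c : Bool) (V : Verifier D noOracle) where

  D' : DynProblem
  D' = record D { answer = answer' }

  module L (n : ℕ) = Layout (space V n) 0 0 0
  open L using (mem; regionCell; mainRegion; aliveCell)

  mainCell : ∀ n → Fin (space V n) → L.Cell n 0
  mainCell n = regionCell mainRegion

  -- The alive cell of the layout is used to hold the negated output bit.
  negatedCell : ∀ n → L.Cell n 0
  negatedCell n = aliveCell

  storeNegatedOutput : ∀ n → CellTree (L.Cell n 0)
  storeNegatedOutput n = rd (mainCell n (xpos V n)) (wr (negatedCell n) true leaf) (wr (negatedCell n) false leaf)

  withNegatedOutput : ∀ n → Vec Bool (space V n) → L.Mem n 0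
  withNegatedOutput n A = mem A [] [] (not (lookup A (xpos V n))) []

  negated : Verifier D' noOracle
  negated = record
    { space = λ n → L.size n 0
    ; plen  = plen V
    ; rlen  = rlen V
    ; time  = λ n → time V n + 2
    ; init  = λ n I₀ → L.encode n (withNegatedOutput n (init V n I₀))
    ; oinit = λ _ _ → tt
    ; tree  = λ n u π → L.compile n (L.embed n mainRegion (tree V n u π) (storeNegatedOutput n))
    ; xpos  = λ n → L.address n (negatedCell n)
    ; ypos  = λ n → map (L.address n) (map (mainCell n) (ypos V n))
    }

  negatedState : ∀ n → Vec Bool (space V n) → State negated n
  negatedState n A = L.encode n (withNegatedOutput n A) , tt

  run-storeNegatedOutput : ∀ n A x → L.run n (storeNegatedOutput n) (mem A [] [] x []) ≡ withNegatedOutput n A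
  run-storeNegatedOutput n A x with lookup A (xpos V n)
  ... | false = refl
  ... | true = refl

  step-negated : ∀ n u π A σ → stepV V {n} u π (A , tt) ≡ just σ →
    stepV negated u π (negatedState n A) ≡ just (negatedState n (proj₁ σ))
  step-negated n u π A σ step≡ = trans
    (L.exec-compile n n (L.embed n mainRegion (tree V n u π) (storeNegatedOutput n)) (withNegatedOutput n A))
    (cong (λ M → just (L.encode n M , tt)) (trans
      (L.run-embed n n mainRegion (tree V n u π) (storeNegatedOutput n) (withNegatedOutput n A) σ step≡)
      (run-storeNegatedOutput n (proj₁ σ) (not (lookup A (xpos V n))))))

  xOut-negated : ∀ n A → xOut negated (negatedState n A) ≡ not (lookup A (xpos V n))
  xOut-negated n A = L.lookup-encode n (withNegatedOutput n A) (negatedCell n)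

  yOut-negated : ∀ n A → yOut negated (negatedState n A) ≡ yOut V {n} (A , tt)
  yOut-negated n A = cong bitsVal (trans
    (L.map-lookup-encode n (withNegatedOutput n A) (map (mainCell n) (ypos V n)))
    (sym (map-∘ (L.get n (withNegatedOutput n A)) (mainCell n) (ypos V n))))

  output-negated : ∀ {n} (I : BitString n) A b → (answer D I ≡ b → lookup A (xpos V n) ≡ b) →
    answer' I ≡ not b → xOut negated (negatedState n A) ≡ not b
  output-negated I A b correct answer'≡ =
    trans (xOut-negated _ A) (cong not (correct (not-injective (trans (sym (answer'≡not I)) answer'≡))))

  sound-negated : ∀ n k (I : BitString n) A → Sound V c k I (A , tt) → Sound negated (not c) k I (negatedState n A)
  sound-negated n zero I A sound = output-negated I A c sound
  sound-negated n (suc k) I A (now , next) = output-negated I A c now , λ u I' eu π →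
    let σ , step≡ , sound' = next u I' eu π in
    _ , step-negated n u π A σ step≡ , sound-negated n k I' (proj₁ σ) sound'

  maximizing-negated : ∀ n u π A → Maximizing negated u π (negatedState n A) → Maximizing V u π (A , tt)
  maximizing-negated n u π A max π' σ₁ σ₂ step₁ step₂ =
    subst₂ _≤_ (yOut-negated n (proj₁ σ₂)) (yOut-negated n (proj₁ σ₁))
      (max π' _ _ (step-negated n u π A σ₁ step₁) (step-negated n u π' A σ₂ step₂))

  complete-negated : ∀ n k (I : BitString n) A → Complete V c k I (A , tt) → Sound∞ V c I (A , tt) →
    Complete negated (not c) k I (negatedState n A)
  complete-negated n zero I A complete _ = output-negated I A (not c) complete
  complete-negated n (suc k) I A (now , next) sound = output-negated I A (not c) now , λ u I' eu π max σ' step≡' →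
    let σ , step≡ , sound' = sound∞-step V sound eu π in
    subst (Complete negated (not c) k I') (just-injective (trans (sym (step-negated n u π A σ step≡)) step≡'))
      (complete-negated n k I' (proj₁ σ) (next u I' eu π (maximizing-negated n u π A max) σ step≡) sound')

  valid-negated : ValidVerifier V c → ValidVerifier negated (not c)
  valid-negated (time≤ , space≤ , plen≤ , rlen≤ , depth≤ , correct) =
    bounded-+ (time V) (λ _ → 2) time≤ (bounded-const 2) ,
    bounded-+ (space V) (λ _ → 1) space≤ (bounded-const 1) ,
    plen≤ , rlen≤ ,
    (λ n u π → begin
      depth (L.compile n (L.embed n mainRegion (tree V n u π) (storeNegatedOutput n)))
        ≡⟨ L.depth-compile n (L.embed n mainRegion (tree V n u π) (storeNegatedOutput n)) ⟩
      cellDepth (L.embed n mainRegion (tree V n u π) (storeNegatedOutput n))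
        ≤⟨ L.cellDepth-embed n mainRegion (tree V n u π) (storeNegatedOutput n) ⟩
      depth (tree V n u π) + 2
        ≤⟨ +-monoˡ-≤ 2 (depth≤ n u π) ⟩
      time V n + 2 ∎) ,
    λ n I₀ k → sound-negated n k I₀ (init V n I₀) (proj₁ (correct n I₀ k)) ,
               complete-negated n k I₀ (init V n I₀) (proj₂ (correct n I₀ k)) (λ k' → proj₁ (correct n I₀ k'))
    where open ≤-Reasoning

-- Stated for any answer function pointwise equal to not ∘ answer D, so that negating complement D
-- gives back D itself rather than complement (complement D).
negate : ∀ c (D : DynProblem) (answer' : ∀ {n} → BitString n → Bool) →
  (∀ {n} (I : BitString n) → answer' I ≡ not (answer D I)) → VClass c D → VClass (not c) (record D { answer = answer' })
negate c D answer' answer'≡not (V , valid) =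
  Negation.negated D answer' answer'≡not c V , Negation.valid-negated D answer' answer'≡not c V valid

-- Answering oracle calls with an NP and a coNP verifier

nothing-or-just : ∀ {A : Set} (x : Maybe A) → x ≡ nothing ⊎ ∃ λ a → x ≡ just a
nothing-or-just nothing = inj₁ refl
nothing-or-just (just a) = inj₂ (a , refl)

module Simulation (D D' : DynProblem) (m : ℕ → ℕ) (b : Bool)
  (V : Verifier D (oracleOn D' m)) (V₁ V₂ : Verifier D' noOracle) (n : ℕ) where

  N sV s₁ s₂ B L : ℕ
  N = m n
  sV = space V n
  s₁ = space V₁ N
  s₂ = space V₂ N
  B = rlen V₁ N + rlen V₂ N
  L = olab (oracleOn D' m n)

  O : Iface
  O = oracleOn D' m n

  open Layout sV s₁ s₂ B public

  Block : Set
  Block = Vec Bool (plen V₁ N) × Vec Bool (plen V₂ N)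

  x₁ : Fin s₁
  x₁ = xpos V₁ N

  x₂ : Fin s₂
  x₂ = xpos V₂ N

  rewardCells : ∀ {j} → Vec (Cell j) B
  rewardCells = map (regionCell region₁) (ypos V₁ N) ++ map (regionCell region₂) (ypos V₂ N)

  rewardSlot : Vec Bool s₁ → Vec Bool s₂ → Vec Bool B
  rewardSlot C E = map (lookup C) (ypos V₁ N) ++ map (lookup E) (ypos V₂ N)

  -- Output b never violates soundness of polarity b, and a dead run is never touched again.
  poison : ∀ {j} → CellTree (Cell j)
  poison = wr aliveCell false (wr (regionCell mainRegion (xpos V n)) b leaf)

  mutual
    simulate : ∀ {j} → Tree sV L → Vec Block j → CellTree (Cell j)
    simulate leaf bs = leaf
    simulate (rd i t₀ t₁) bs = rd (regionCell mainRegion i) (simulate t₀ bs) (simulate t₁ bs)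
    simulate (wr i x t) bs = wr (regionCell mainRegion i) x (simulate t bs)
    simulate (call v t₀ t₁) [] = poison
    simulate (call v t₀ t₁) ((π₁ , π₂) ∷ bs) =
      embed region₁ (tree V₁ N v π₁) (embed region₂ (tree V₂ N v π₂)
        (copy rewardCells (λ i → i) (branch t₀ t₁ bs)))

    branch : ∀ {j} → Tree sV L → Tree sV L → Vec Block j → CellTree (Cell (suc j))
    branch t₀ t₁ bs = rd (regionCell region₁ x₁)
      (rd (regionCell region₂ x₂) (relabel liftCell (simulate t₀ bs)) poison)
      (relabel liftCell (simulate t₁ bs))

  oracleMems : ∀ {j} → Mem j → Vec Bool s₁ → Vec Bool s₂ → Mem j
  oracleMems M C E = record M { mem₁ = C ; mem₂ = E }

  map-get-rewardCells : ∀ {j} (M : Mem j) → map (get M) rewardCells ≡ rewardSlot (mem₁ M) (mem₂ M)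
  map-get-rewardCells M =
    trans (map-++ (get M) (map (regionCell region₁) (ypos V₁ N)) (map (regionCell region₂) (ypos V₂ N)))
    (cong₂ _++_ (sym (map-∘ (get M) (regionCell region₁) (ypos V₁ N)))
                (sym (map-∘ (get M) (regionCell region₂) (ypos V₂ N))))

  run-call : ∀ {j} v t₀ t₁ π₁ π₂ (bs : Vec Block j) w (M : Mem j) {σ₁ σ₂} →
    stepV V₁ v π₁ (mem₁ M , tt) ≡ just σ₁ → stepV V₂ v π₂ (mem₂ M , tt) ≡ just σ₂ →
    run (simulate (call v t₀ t₁) ((π₁ , π₂) ∷ bs)) (push w M)
      ≡ run (branch t₀ t₁ bs) (push (rewardSlot (proj₁ σ₁) (proj₁ σ₂)) (oracleMems M (proj₁ σ₁) (proj₁ σ₂)))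
  run-call v t₀ t₁ π₁ π₂ bs w M {σ₁} {σ₂} step₁ step₂ = begin
    run (simulate (call v t₀ t₁) ((π₁ , π₂) ∷ bs)) (push w M)
      ≡⟨ run-embed N region₁ (tree V₁ N v π₁) _ (push w M) σ₁ step₁ ⟩
    run (embed region₂ (tree V₂ N v π₂) K) (push w (replace region₁ (proj₁ σ₁) M))
      ≡⟨ run-embed N region₂ (tree V₂ N v π₂) K _ σ₂ step₂ ⟩
    run K (push w M')
      ≡⟨ run-copy rewardCells (λ i → i) (branch t₀ t₁ bs) w M' ⟩
    run (branch t₀ t₁ bs) (push (writeAll (get M') w rewardCells (λ i → i)) M')
      ≡⟨ cong (λ w' → run (branch t₀ t₁ bs) (push w' M'))
              (trans (writeAll-id (get M') w rewardCells) (map-get-rewardCells M')) ⟩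
    run (branch t₀ t₁ bs) (push (rewardSlot (proj₁ σ₁) (proj₁ σ₂)) M') ∎
    where
    open ≡-Reasoning
    K : CellTree (Cell (suc _))
    K = copy rewardCells (λ i → i) (branch t₀ t₁ bs)
    M' : Mem _
    M' = oracleMems M (proj₁ σ₁) (proj₁ σ₂)

  Poisoned : ∀ {j} → Mem j → Set
  Poisoned M = alive M ≡ false × lookup (main M) (xpos V n) ≡ b

  poison-poisons : ∀ {j} (M : Mem j) → Poisoned (run poison M)
  poison-poisons M = refl , lookup∘update (xpos V n) (main M) b

  branch-accept : ∀ {j} t₀ t₁ (bs : Vec Block j) w (M : Mem j) → lookup (mem₁ M) x₁ ≡ true →
    run (branch t₀ t₁ bs) (push w M) ≡ push w (run (simulate t₁ bs) M)
  branch-accept t₀ t₁ bs w M accepted rewrite accepted = run-liftCell (simulate t₁ bs) w M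

  branch-reject : ∀ {j} t₀ t₁ (bs : Vec Block j) w (M : Mem j) →
    lookup (mem₁ M) x₁ ≡ false → lookup (mem₂ M) x₂ ≡ false →
    run (branch t₀ t₁ bs) (push w M) ≡ push w (run (simulate t₀ bs) M)
  branch-reject t₀ t₁ bs w M rejected₁ rejected₂ rewrite rejected₁ | rejected₂ = run-liftCell (simulate t₀ bs) w M

  slots-branch : ∀ {j} t₀ t₁ (bs : Vec Block j) w (M : Mem j) →
    ∃ λ ws → slots (run (branch t₀ t₁ bs) (push w M)) ≡ w ∷ ws
  slots-branch t₀ t₁ bs w M with lookup (mem₁ M) x₁ | lookup (mem₂ M) x₂
  ... | true  | _     = _ , cong slots (run-liftCell (simulate t₁ bs) w M)
  ... | false | true  = _ , refl
  ... | false | false = _ , cong slots (run-liftCell (simulate t₀ bs) w M)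

  exec-call-accept : ∀ {v J J''} {A : Vec Bool sV} (t₀ t₁ : Tree sV L) →
    upd D' J v ≡ just J'' → answer D' J'' ≡ true → exec O (call v t₀ t₁) (A , J) ≡ exec O t₁ (A , J'')
  exec-call-accept t₀ t₁ eu accepted rewrite eu | accepted = refl

  exec-call-reject : ∀ {v J J''} {A : Vec Bool sV} (t₀ t₁ : Tree sV L) →
    upd D' J v ≡ just J'' → answer D' J'' ≡ false → exec O (call v t₀ t₁) (A , J) ≡ exec O t₀ (A , J'')
  exec-call-reject t₀ t₁ eu rejected rewrite eu | rejected = refl

  exec-call-invalid : ∀ {v J} {A : Vec Bool sV} (t₀ t₁ : Tree sV L) →
    upd D' J v ≡ nothing → exec O (call v t₀ t₁) (A , J) ≡ nothing
  exec-call-invalid t₀ t₁ eu rewrite eu = refl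

  Sound₁ : BitString N → Vec Bool s₁ → Set
  Sound₁ J C = Sound∞ V₁ false J (C , tt)

  Sound₂ : BitString N → Vec Bool s₂ → Set
  Sound₂ J E = Sound∞ V₂ true J (E , tt)

  Complete₁ : BitString N → Vec Bool s₁ → Set
  Complete₁ J C = Complete∞ V₁ false J (C , tt)

  Complete₂ : BitString N → Vec Bool s₂ → Set
  Complete₂ J E = Complete∞ V₂ true J (E , tt)

  accept-sound : ∀ {J C} → Sound₁ J C → lookup C x₁ ≡ true → answer D' J ≡ true
  accept-sound {J} sound accepted with answer D' J in answer≡
  ... | true = refl
  ... | false with trans (sym accepted) (sound 0 answer≡)
  ...   | ()

  reject-sound : ∀ {J E} → Sound₂ J E → lookup E x₂ ≡ false → answer D' J ≡ false
  reject-sound {J} sound rejected with answer D' J in answer≡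
  ... | false = refl
  ... | true with trans (sym rejected) (sound 0 answer≡)
  ...   | ()

  Tracks : ∀ {j} → BitString N → Mem j → Set
  Tracks J M = Sound₁ J (mem₁ M) × Sound₂ J (mem₂ M)

  Outcome : ∀ {j} → BitString N → Vec Bool sV → Mem j → Set
  Outcome J' A' M = Poisoned M ⊎ (alive M ≡ true × main M ≡ A' × Tracks J' M)

  mutual
    simulate-sound : ∀ {j} t (bs : Vec Block j) (M : Mem j) {J J' A'} → alive M ≡ true → Tracks J M →
      exec O t (main M , J) ≡ just (A' , J') → Outcome J' A' (run (simulate t bs) M)
    simulate-sound leaf bs M alive≡ tracks refl = inj₂ (alive≡ , refl , tracks)
    simulate-sound (rd i t₀ t₁) bs M alive≡ tracks ex with lookup (main M) i
    ... | false = simulate-sound t₀ bs M alive≡ tracks ex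
    ... | true = simulate-sound t₁ bs M alive≡ tracks ex
    simulate-sound (wr i x t) bs M alive≡ tracks ex = simulate-sound t bs _ alive≡ tracks ex
    simulate-sound (call v t₀ t₁) [] M alive≡ tracks ex = inj₁ (poison-poisons M)
    simulate-sound (call v t₀ t₁) ((π₁ , π₂) ∷ bs) (mem A C E e (w ∷ M)) {J} alive≡ (sound₁ , sound₂) ex
      with nothing-or-just (upd D' J v)
    ... | inj₁ invalid with trans (sym (exec-call-invalid t₀ t₁ invalid)) ex
    ...   | ()
    simulate-sound (call v t₀ t₁) ((π₁ , π₂) ∷ bs) (mem A C E e (w ∷ M)) alive≡ (sound₁ , sound₂) ex
      | inj₂ (J'' , eu) with sound∞-step V₁ sound₁ eu π₁ | sound∞-step V₂ sound₂ eu π₂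
    ... | σ₁ , step₁ , sound₁' | σ₂ , step₂ , sound₂' =
      subst (Outcome _ _) (sym (run-call v t₀ t₁ π₁ π₂ bs w (mem A C E e M) step₁ step₂))
        (branch-sound t₀ t₁ bs _ (oracleMems (mem A C E e M) (proj₁ σ₁) (proj₁ σ₂)) eu alive≡
          (sound₁' , sound₂') ex)

    branch-sound : ∀ {j} t₀ t₁ (bs : Vec Block j) w (M : Mem j) {v J J'' J' A'} → upd D' J v ≡ just J'' →
      alive M ≡ true → Tracks J'' M → exec O (call v t₀ t₁) (main M , J) ≡ just (A' , J') →
      Outcome J' A' (run (branch t₀ t₁ bs) (push w M))
    branch-sound t₀ t₁ bs w M {J' = J'} {A'} eu alive≡ tracks@(sound₁ , sound₂) ex
      with lookup (mem₁ M) x₁ in x₁≡ | lookup (mem₂ M) x₂ in x₂≡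
    ... | true | _ = subst (Outcome J' A') (sym (run-liftCell (simulate t₁ bs) w M))
      (simulate-sound t₁ bs M alive≡ tracks (trans (sym (exec-call-accept t₀ t₁ eu (accept-sound sound₁ x₁≡))) ex))
    ... | false | true = inj₁ (poison-poisons (push w M))
    ... | false | false = subst (Outcome J' A') (sym (run-liftCell (simulate t₀ bs) w M))
      (simulate-sound t₀ bs M alive≡ tracks (trans (sym (exec-call-reject t₀ t₁ eu (reject-sound sound₂ x₂≡))) ex))

  Faithful : ∀ {j} → BitString N → Mem j → Set
  Faithful J M = Tracks J M × Complete₁ J (mem₁ M) × Complete₂ J (mem₂ M)

  Reproduces : ∀ {j} → BitString N → Vec Bool sV → Mem j → Set
  Reproduces J' A' M = main M ≡ A' × Faithful J' M

  Simulates : ∀ {j} → BitString N → Vec Bool sV → Mem j → Set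
  Simulates J' A' M = alive M ≡ true × Reproduces J' A' M

  accept-faithful : ∀ {J C} → Sound₁ J C → Complete₁ J C → lookup C x₁ ≡ answer D' J
  accept-faithful {J} sound complete with answer D' J in answer≡
  ... | true = complete 0 answer≡
  ... | false = sound 0 answer≡

  reject-faithful : ∀ {J E} → Sound₂ J E → Complete₂ J E → lookup E x₂ ≡ answer D' J
  reject-faithful {J} sound complete with answer D' J in answer≡
  ... | true = sound 0 answer≡
  ... | false = complete 0 answer≡

  faithful-step : ∀ {j} (M : Mem j) {v J J'' π₁ π₂ σ₁ σ₂} → upd D' J v ≡ just J'' → Faithful J M →
    Maximizing V₁ v π₁ (mem₁ M , tt) → stepV V₁ v π₁ (mem₁ M , tt) ≡ just σ₁ →
    Maximizing V₂ v π₂ (mem₂ M , tt) → stepV V₂ v π₂ (mem₂ M , tt) ≡ just σ₂ →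
    Faithful J'' (oracleMems M (proj₁ σ₁) (proj₁ σ₂))
  faithful-step M eu ((sound₁ , sound₂) , complete₁ , complete₂) max₁ step₁ max₂ step₂ =
    (sound∞-next V₁ sound₁ eu step₁ , sound∞-next V₂ sound₂ eu step₂) ,
    complete∞-step V₁ complete₁ eu max₁ step₁ , complete∞-step V₂ complete₂ eu max₂ step₂

  -- Blocks beyond the last oracle call of a run are never read.
  anyBlocks : ∀ j → Vec Block j
  anyBlocks j = replicate j (replicate _ false , replicate _ false)

  mutual
    faithful-run-exists : ∀ {j} t (M : Mem j) {J J' A'} →
      depth t ≤ j → alive M ≡ true → Faithful J M → exec O t (main M , J) ≡ just (A' , J') →
      ∃ λ bs → Simulates J' A' (run (simulate t bs) M)
    faithful-run-exists leaf M _ alive≡ faithful refl = anyBlocks _ , alive≡ , refl , faithful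
    faithful-run-exists (rd i t₀ t₁) M d alive≡ faithful ex with lookup (main M) i
    ... | false = faithful-run-exists t₀ M (m⊔n≤o⇒m≤o _ _ (<⇒≤ d)) alive≡ faithful ex
    ... | true = faithful-run-exists t₁ M (m⊔n≤o⇒n≤o _ _ (<⇒≤ d)) alive≡ faithful ex
    faithful-run-exists (wr i x t) M d alive≡ faithful ex = faithful-run-exists t _ (<⇒≤ d) alive≡ faithful ex
    faithful-run-exists {zero} (call v t₀ t₁) M () alive≡ faithful ex
    faithful-run-exists {suc j} (call v t₀ t₁) (mem A C E e (w ∷ M)) {J} d alive≡ faithful ex
      with nothing-or-just (upd D' J v)
    ... | inj₁ invalid with trans (sym (exec-call-invalid t₀ t₁ invalid)) ex
    ...   | ()
    faithful-run-exists {suc j} (call v t₀ t₁) (mem A C E e (w ∷ M)) {J' = J'} {A'} d alive≡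
      faithful@((sound₁ , sound₂) , _) ex | inj₂ (J'' , eu) =
      let π₁ , max₁ = maximizing-exists V₁ v (C , tt)
          π₂ , max₂ = maximizing-exists V₂ v (E , tt)
          σ₁ , step₁ , _ = sound∞-step V₁ sound₁ eu π₁
          σ₂ , step₂ , _ = sound∞-step V₂ sound₂ eu π₂
          M' = oracleMems (mem A C E e M) (proj₁ σ₁) (proj₁ σ₂)
          bs , simulates = branch-faithful-exists t₀ t₁ (rewardSlot (proj₁ σ₁) (proj₁ σ₂)) M' eu
            (m⊔n≤o⇒m≤o _ _ (s≤s⁻¹ d)) (m⊔n≤o⇒n≤o _ _ (s≤s⁻¹ d)) alive≡
            (faithful-step (mem A C E e M) eu faithful max₁ step₁ max₂ step₂) ex
      in (π₁ , π₂) ∷ bs ,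
         subst (Simulates J' A') (sym (run-call v t₀ t₁ π₁ π₂ bs w (mem A C E e M) step₁ step₂)) simulates

    branch-faithful-exists : ∀ {j} t₀ t₁ w (M : Mem j) {v J J'' J' A'} → upd D' J v ≡ just J'' →
      depth t₀ ≤ j → depth t₁ ≤ j → alive M ≡ true → Faithful J'' M →
      exec O (call v t₀ t₁) (main M , J) ≡ just (A' , J') →
      ∃ λ bs → Simulates J' A' (run (branch t₀ t₁ bs) (push w M))
    branch-faithful-exists t₀ t₁ w M {J'' = J''} {J'} {A'} eu d₀ d₁ alive≡
      faithful@((sound₁ , sound₂) , complete₁ , complete₂) ex with answer D' J'' in answer≡
    ... | true =
      let bs , simulates = faithful-run-exists t₁ M d₁ alive≡ faithful (trans (sym (exec-call-accept t₀ t₁ eu answer≡)) ex)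
          accepted = trans (accept-faithful sound₁ complete₁) answer≡
      in bs , subst (Simulates J' A') (sym (branch-accept t₀ t₁ bs w M accepted)) simulates
    ... | false =
      let bs , simulates = faithful-run-exists t₀ M d₀ alive≡ faithful (trans (sym (exec-call-reject t₀ t₁ eu answer≡)) ex)
          rejected₁ = trans (accept-faithful sound₁ complete₁) answer≡
          rejected₂ = trans (reject-faithful sound₂ complete₂) answer≡
      in bs , subst (Simulates J' A') (sym (branch-reject t₀ t₁ bs w M rejected₁ rejected₂)) simulates

  SlotMaximal : ∀ {j k} → (Vec Block j → Mem k) → Vec Block j → Set
  SlotMaximal R bs = ∀ bs' → alive (R bs') ≡ true → bitsVal (concat (slots (R bs'))) ≤ bitsVal (concat (slots (R bs)))

  slotMaximal-≗ : ∀ {j k} {R R' : Vec Block j → Mem k} {bs} →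
    (∀ bs' → R bs' ≡ R' bs') → SlotMaximal R bs → SlotMaximal R' bs
  slotMaximal-≗ {R = R} {R'} {bs} R≗R' max bs' alive≡ =
    subst₂ (λ X Y → bitsVal (concat (slots X)) ≤ bitsVal (concat (slots Y))) (R≗R' bs') (R≗R' bs)
      (max bs' (subst (λ X → alive X ≡ true) (sym (R≗R' bs')) alive≡))

  slotMaximal-push : ∀ {j k} (R : Vec Block j → Mem k) {bs} w →
    SlotMaximal (λ bs' → push w (R bs')) bs → SlotMaximal R bs
  slotMaximal-push R w max bs' alive≡ = bitsVal-++-≤ʳ w _ _ (max bs' alive≡)

  -- Comparing with runs whose first block is (π₁* , π₂*) and then (π₁ , π₂*), for reward-maximizing
  -- π₁* and π₂* (such runs can be kept alive), shows that both proofs of the first block maximize reward.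
  module SlotMaximalFirstBlock {j} v t₀ t₁ w (M : Mem j) {J J'' J' A'} π₁ π₂ (bs : Vec Block j) {σ₁ σ₂}
    (eu : upd D' J v ≡ just J'') (d₀ : depth t₀ ≤ j) (d₁ : depth t₁ ≤ j)
    (alive≡ : alive M ≡ true) (faithful : Faithful J M) (ex : exec O (call v t₀ t₁) (main M , J) ≡ just (A' , J'))
    (step₁ : stepV V₁ v π₁ (mem₁ M , tt) ≡ just σ₁) (step₂ : stepV V₂ v π₂ (mem₂ M , tt) ≡ just σ₂)
    (max : SlotMaximal (λ bs' → run (simulate (call v t₀ t₁) bs') (push w M)) ((π₁ , π₂) ∷ bs)) where

    ybits₁ : State V₁ N → Vec Bool (rlen V₁ N)
    ybits₁ σ = map (lookup (proj₁ σ)) (ypos V₁ N)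

    ybits₂ : State V₂ N → Vec Bool (rlen V₂ N)
    ybits₂ σ = map (lookup (proj₁ σ)) (ypos V₂ N)

    first-slot-≤ : ∀ {π₁' π₂'} bs' {σ₁' σ₂'} →
      stepV V₁ v π₁' (mem₁ M , tt) ≡ just σ₁' → stepV V₂ v π₂' (mem₂ M , tt) ≡ just σ₂' →
      alive (run (branch t₀ t₁ bs')
                 (push (rewardSlot (proj₁ σ₁') (proj₁ σ₂')) (oracleMems M (proj₁ σ₁') (proj₁ σ₂')))) ≡ true →
      bitsVal (ybits₁ σ₁' ++ ybits₂ σ₂') ≤ bitsVal (ybits₁ σ₁ ++ ybits₂ σ₂)
    first-slot-≤ {π₁'} {π₂'} bs' {σ₁'} {σ₂'} step₁' step₂' alive' =
      let slot = rewardSlot (proj₁ σ₁) (proj₁ σ₂)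
          slot' = rewardSlot (proj₁ σ₁') (proj₁ σ₂')
          ws , slots≡ = slots-branch t₀ t₁ bs slot (oracleMems M (proj₁ σ₁) (proj₁ σ₂))
          ws' , slots≡' = slots-branch t₀ t₁ bs' slot' (oracleMems M (proj₁ σ₁') (proj₁ σ₂'))
          call≡ = run-call v t₀ t₁ π₁ π₂ bs w M step₁ step₂
          call≡' = run-call v t₀ t₁ π₁' π₂' bs' w M step₁' step₂'
      in bitsVal-++-≤ˡ slot slot' (concat ws) (concat ws')
           (subst₂ (λ X Y → bitsVal (concat X) ≤ bitsVal (concat Y))
             (trans (cong slots call≡') slots≡') (trans (cong slots call≡) slots≡)
             (max ((π₁' , π₂') ∷ bs') (subst (λ X → alive X ≡ true) (sym call≡') alive')))

    maximizing₁ : Maximizing V₁ v π₁ (mem₁ M , tt)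
    maximizing₁ =
      let π₁* , max₁* = maximizing-exists V₁ v (mem₁ M , tt)
          π₂* , max₂* = maximizing-exists V₂ v (mem₂ M , tt)
          σ₁* , step₁* , _ = sound∞-step V₁ (proj₁ (proj₁ faithful)) eu π₁*
          σ₂* , step₂* , _ = sound∞-step V₂ (proj₂ (proj₁ faithful)) eu π₂*
          bs* , alive* , _ = branch-faithful-exists t₀ t₁ _ (oracleMems M (proj₁ σ₁*) (proj₁ σ₂*)) eu d₀ d₁ alive≡
                               (faithful-step M eu faithful max₁* step₁* max₂* step₂*) ex
      in maximizing-if-reward-≥ V₁ step₁ max₁* step₁*
           (bitsVal-++-≤ˡ (ybits₁ σ₁) (ybits₁ σ₁*) (ybits₂ σ₂) (ybits₂ σ₂*)
             (first-slot-≤ bs* step₁* step₂* alive*))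

    maximizing₂ : Maximizing V₂ v π₂ (mem₂ M , tt)
    maximizing₂ =
      let π₂* , max₂* = maximizing-exists V₂ v (mem₂ M , tt)
          σ₂* , step₂* , _ = sound∞-step V₂ (proj₂ (proj₁ faithful)) eu π₂*
          bs* , alive* , _ = branch-faithful-exists t₀ t₁ _ (oracleMems M (proj₁ σ₁) (proj₁ σ₂*)) eu d₀ d₁ alive≡
                               (faithful-step M eu faithful maximizing₁ step₁ max₂* step₂*) ex
      in maximizing-if-reward-≥ V₂ step₂ max₂* step₂*
           (bitsVal-++-≤ʳ (ybits₁ σ₁) (ybits₂ σ₂) (ybits₂ σ₂*) (first-slot-≤ bs* step₁ step₂* alive*))

  mutual
    simulate-maximal : ∀ {j} t (M : Mem j) {J J' A'} (bs : Vec Block j) →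
      depth t ≤ j → alive M ≡ true → Faithful J M → exec O t (main M , J) ≡ just (A' , J') →
      alive (run (simulate t bs) M) ≡ true →
      SlotMaximal (λ bs' → run (simulate t bs') M) bs → Reproduces J' A' (run (simulate t bs) M)
    simulate-maximal leaf M bs _ _ faithful refl _ _ = refl , faithful
    simulate-maximal (rd i t₀ t₁) M bs d alive≡ faithful ex alive' max with lookup (main M) i
    ... | false = simulate-maximal t₀ M bs (m⊔n≤o⇒m≤o _ _ (<⇒≤ d)) alive≡ faithful ex alive' max
    ... | true = simulate-maximal t₁ M bs (m⊔n≤o⇒n≤o _ _ (<⇒≤ d)) alive≡ faithful ex alive' max
    simulate-maximal (wr i x t) M bs d alive≡ faithful ex alive' max =
      simulate-maximal t _ bs (<⇒≤ d) alive≡ faithful ex alive' max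
    simulate-maximal (call v t₀ t₁) M [] d alive≡ faithful ex () max
    simulate-maximal (call v t₀ t₁) (mem A C E e (w ∷ M)) {J} ((π₁ , π₂) ∷ bs) d alive≡ faithful ex alive' max
      with nothing-or-just (upd D' J v)
    ... | inj₁ invalid with trans (sym (exec-call-invalid t₀ t₁ invalid)) ex
    ...   | ()
    simulate-maximal {suc j} (call v t₀ t₁) (mem A C E e (w ∷ M)) {J' = J'} {A'} ((π₁ , π₂) ∷ bs) d alive≡
      faithful@((sound₁ , sound₂) , _) ex alive' max | inj₂ (J'' , eu)
      with sound∞-step V₁ sound₁ eu π₁ | sound∞-step V₂ sound₂ eu π₂
    ... | σ₁ , step₁ , _ | σ₂ , step₂ , _ =
      subst (Reproduces J' A') (sym (call≡ bs))
        (branch-maximal t₀ t₁ bs _ _ eu d₀ d₁ alive≡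
          (faithful-step M₀ eu faithful maximizing₁ step₁ maximizing₂ step₂) ex
          (subst (λ X → alive X ≡ true) (call≡ bs) alive') (slotMaximal-≗ call≡ (λ bs' → max ((π₁ , π₂) ∷ bs'))))
      where
      M₀ : Mem j
      M₀ = mem A C E e M
      d₀ : depth t₀ ≤ j
      d₀ = m⊔n≤o⇒m≤o (depth t₀) (depth t₁) (s≤s⁻¹ d)
      d₁ : depth t₁ ≤ j
      d₁ = m⊔n≤o⇒n≤o (depth t₀) (depth t₁) (s≤s⁻¹ d)
      call≡ : ∀ bs' → run (simulate (call v t₀ t₁) ((π₁ , π₂) ∷ bs')) (push w M₀)
        ≡ run (branch t₀ t₁ bs') (push (rewardSlot (proj₁ σ₁) (proj₁ σ₂)) (oracleMems M₀ (proj₁ σ₁) (proj₁ σ₂)))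
      call≡ bs' = run-call v t₀ t₁ π₁ π₂ bs' w M₀ step₁ step₂
      open SlotMaximalFirstBlock v t₀ t₁ w M₀ π₁ π₂ bs eu d₀ d₁ alive≡ faithful ex step₁ step₂ max

    branch-maximal : ∀ {j} t₀ t₁ (bs : Vec Block j) w (M : Mem j) {v J J'' J' A'} → upd D' J v ≡ just J'' →
      depth t₀ ≤ j → depth t₁ ≤ j → alive M ≡ true → Faithful J'' M →
      exec O (call v t₀ t₁) (main M , J) ≡ just (A' , J') →
      alive (run (branch t₀ t₁ bs) (push w M)) ≡ true → SlotMaximal (λ bs' → run (branch t₀ t₁ bs') (push w M)) bs →
      Reproduces J' A' (run (branch t₀ t₁ bs) (push w M))
    branch-maximal t₀ t₁ bs w M {J'' = J''} {J'} {A'} eu d₀ d₁ alive≡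
      faithful@((sound₁ , sound₂) , complete₁ , complete₂) ex alive' max with answer D' J'' in answer≡
    ... | true = subst (Reproduces J' A') (sym (branch≡ bs))
      (simulate-maximal t₁ M bs d₁ alive≡ faithful (trans (sym (exec-call-accept t₀ t₁ eu answer≡)) ex)
        (subst (λ X → alive X ≡ true) (branch≡ bs) alive')
        (slotMaximal-push (λ bs' → run (simulate t₁ bs') M) w (slotMaximal-≗ branch≡ max)))
      where
      branch≡ : ∀ bs' → run (branch t₀ t₁ bs') (push w M) ≡ push w (run (simulate t₁ bs') M)
      branch≡ bs' = branch-accept t₀ t₁ bs' w M (trans (accept-faithful sound₁ complete₁) answer≡)
    ... | false = subst (Reproduces J' A') (sym (branch≡ bs))
      (simulate-maximal t₀ M bs d₀ alive≡ faithful (trans (sym (exec-call-reject t₀ t₁ eu answer≡)) ex)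
        (subst (λ X → alive X ≡ true) (branch≡ bs) alive')
        (slotMaximal-push (λ bs' → run (simulate t₀ bs') M) w (slotMaximal-≗ branch≡ max)))
      where
      branch≡ : ∀ bs' → run (branch t₀ t₁ bs') (push w M) ≡ push w (run (simulate t₀ bs') M)
      branch≡ bs' = branch-reject t₀ t₁ bs' w M (trans (accept-faithful sound₁ complete₁) answer≡)
                                              (trans (reject-faithful sound₂ complete₂) answer≡)

  -- An oracle call runs V₁ and V₂, copies the B reward bits (a read and a write each) and branches twice.
  callCost : ℕ
  callCost = time V₁ N + time V₂ N + B * 2 + 2

  2≤callCost : 2 ≤ callCost
  2≤callCost = m≤n+m 2 _

  cellDepth-simulate : (∀ v π → depth (tree V₁ N v π) ≤ time V₁ N) →
    (∀ v π → depth (tree V₂ N v π) ≤ time V₂ N) →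
    ∀ {j} (t : Tree sV L) (bs : Vec Block j) → cellDepth (simulate t bs) ≤ suc (depth t) * callCost
  cellDepth-simulate depth₁≤ depth₂≤ = go
    where
    open ≤-Reasoning
    K : ℕ
    K = callCost
    1+≤K+ : ∀ {x X} → x ≤ X → suc x ≤ K + X
    1+≤K+ x≤X = +-mono-≤ (≤-trans (s≤s z≤n) 2≤callCost) x≤X
    go : ∀ {j} (t : Tree sV L) (bs : Vec Block j) → cellDepth (simulate t bs) ≤ suc (depth t) * K
    go-⊔ : ∀ {j} (t₀ t₁ : Tree sV L) (bs : Vec Block j) →
      cellDepth (simulate t₀ bs) ⊔ cellDepth (simulate t₁ bs) ≤ suc (depth t₀ ⊔ depth t₁) * K
    go-⊔ t₀ t₁ bs = ⊔-lub (≤-trans (go t₀ bs) (*-monoˡ-≤ K (s≤s (m≤m⊔n (depth t₀) (depth t₁)))))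
                          (≤-trans (go t₁ bs) (*-monoˡ-≤ K (s≤s (m≤n⊔m (depth t₀) (depth t₁)))))
    go leaf bs = z≤n
    go (rd i t₀ t₁) bs = 1+≤K+ (go-⊔ t₀ t₁ bs)
    go (wr i x t) bs = 1+≤K+ (go t bs)
    go (call v t₀ t₁) [] = ≤-trans 2≤callCost (m≤m+n K _)
    go (call v t₀ t₁) ((π₁ , π₂) ∷ bs) = begin
      cellDepth (embed region₁ (tree V₁ N v π₁) (embed region₂ (tree V₂ N v π₂) copied))
        ≤⟨ cellDepth-embed region₁ (tree V₁ N v π₁) _ ⟩
      depth (tree V₁ N v π₁) + cellDepth (embed region₂ (tree V₂ N v π₂) copied)
        ≤⟨ +-mono-≤ (depth₁≤ v π₁) (cellDepth-embed region₂ (tree V₂ N v π₂) _) ⟩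
      time V₁ N + (depth (tree V₂ N v π₂) + cellDepth copied)
        ≡⟨ cong (λ c → time V₁ N + (depth (tree V₂ N v π₂) + c))
                (cellDepth-copy rewardCells (λ i → i) (branch t₀ t₁ bs)) ⟩
      time V₁ N + (depth (tree V₂ N v π₂) + (B * 2 + cellDepth (branch t₀ t₁ bs)))
        ≤⟨ +-monoʳ-≤ (time V₁ N) (+-mono-≤ (depth₂≤ v π₂) (+-monoʳ-≤ (B * 2) branch≤)) ⟩
      time V₁ N + (time V₂ N + (B * 2 + (2 + X)))
        ≡⟨ solve 5 (λ a b c d x → a :+ (b :+ (c :+ (d :+ x))) := a :+ b :+ c :+ d :+ x) refl
                 (time V₁ N) (time V₂ N) (B * 2) 2 X ⟩
      K + X ∎
      where
      copied : CellTree (Cell (suc _))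
      copied = copy rewardCells (λ i → i) (branch t₀ t₁ bs)
      X : ℕ
      X = suc (depth t₀ ⊔ depth t₁) * K
      lifted≤ : ∀ t → depth t ≤ depth t₀ ⊔ depth t₁ → cellDepth (relabel liftCell (simulate t bs)) ≤ X
      lifted≤ t d = begin
        cellDepth (relabel liftCell (simulate t bs)) ≡⟨ cellDepth-relabel liftCell (simulate t bs) ⟩
        cellDepth (simulate t bs)                    ≤⟨ go t bs ⟩
        suc (depth t) * K                            ≤⟨ *-monoˡ-≤ K (s≤s d) ⟩
        X                                            ∎
      branch≤ : cellDepth (branch t₀ t₁ bs) ≤ 2 + X
      branch≤ = s≤s (⊔-lub
        (s≤s (⊔-lub (lifted≤ t₀ (m≤m⊔n (depth t₀) (depth t₁))) (≤-trans 2≤callCost (m≤m+n K _))))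
        (m≤n⇒m≤1+n (lifted≤ t₁ (m≤n⊔m (depth t₀) (depth t₁)))))

-- Eliminating an oracle in NP ∩ coNP

take-++ : ∀ {A : Set} {a c} (xs : Vec A a) (ys : Vec A c) → take a (xs ++ ys) ≡ xs
take-++ [] ys = refl
take-++ (x ∷ xs) ys = cong (x ∷_) (take-++ xs ys)

drop-++ : ∀ {A : Set} {a c} (xs : Vec A a) (ys : Vec A c) → drop a (xs ++ ys) ≡ ys
drop-++ [] ys = refl
drop-++ (x ∷ xs) ys = drop-++ xs ys

module _ {A : Set} (p₁ p₂ : ℕ) where

  encodePairs : ∀ {j} → Vec (Vec A p₁ × Vec A p₂) j → Vec A (j * (p₁ + p₂))
  encodePairs [] = []
  encodePairs ((xs , ys) ∷ ps) = (xs ++ ys) ++ encodePairs ps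

  decodePairs : ∀ j → Vec A (j * (p₁ + p₂)) → Vec (Vec A p₁ × Vec A p₂) j
  decodePairs zero _ = []
  decodePairs (suc j) zs =
    (take p₁ (take (p₁ + p₂) zs) , drop p₁ (take (p₁ + p₂) zs)) ∷ decodePairs j (drop (p₁ + p₂) zs)

  decodePairs-encodePairs : ∀ {j} (ps : Vec (Vec A p₁ × Vec A p₂) j) → decodePairs j (encodePairs ps) ≡ ps
  decodePairs-encodePairs [] = refl
  decodePairs-encodePairs ((xs , ys) ∷ ps)
    rewrite take-++ (xs ++ ys) (encodePairs ps) | drop-++ (xs ++ ys) (encodePairs ps) | take-++ xs ys | drop-++ xs ys =
    cong ((xs , ys) ∷_) (decodePairs-encodePairs ps)

module Collapse (D D' : DynProblem) (m : ℕ → ℕ) (b : Bool)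
  (V : Verifier D (oracleOn D' m)) (V₁ V₂ : Verifier D' noOracle) where

  module S (n : ℕ) = Simulation D D' m b V V₁ V₂ n
  open S using (mem; main; mem₁; mem₂; alive; slots; regionCell; mainRegion; aliveCell)

  T : ℕ → ℕ
  T = time V

  -- V makes at most T n oracle calls in one step, so a proof for W is a proof for V and T n blocks.
  Certificate : ℕ → Set
  Certificate n = Vec Bool (plen V n) × Vec (S.Block n) (T n)

  certLen : ℕ → ℕ
  certLen n = plen V n + T n * (plen V₁ (m n) + plen V₂ (m n))

  decode : ∀ n → Vec Bool (certLen n) → Certificate n
  decode n π = take (plen V n) π , decodePairs (plen V₁ (m n)) (plen V₂ (m n)) (T n) (drop (plen V n) π)

  encode : ∀ n → Certificate n → Vec Bool (certLen n)
  encode n (πV , bs) = πV ++ encodePairs (plen V₁ (m n)) (plen V₂ (m n)) bs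

  decode-encode : ∀ n c → decode n (encode n c) ≡ c
  decode-encode n (πV , bs) rewrite take-++ πV (encodePairs _ _ bs) | drop-++ πV (encodePairs _ _ bs) =
    cong (πV ,_) (decodePairs-encodePairs _ _ bs)

  Mem : ℕ → Set
  Mem n = S.Mem n (T n)

  runSimulation : ∀ n → BitString (ulen D n) → Certificate n → Mem n → Mem n
  runSimulation n u (πV , bs) = S.run n (S.simulate n (tree V n u πV) bs)

  stepTree : ∀ n → BitString (ulen D n) → Certificate n → CellTree (S.Cell n (T n))
  stepTree n u (πV , bs) = rd aliveCell leaf (S.simulate n (tree V n u πV) bs)

  initMem : ∀ n → BitString n → Mem n
  initMem n I₀ = mem (init V n I₀) (init V₁ (m n) (oinit V n I₀)) (init V₂ (m n) (oinit V n I₀)) true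
                     (replicate (T n) (replicate _ false))

  mainCell : ∀ n → Fin (space V n) → S.Cell n (T n)
  mainCell n = regionCell mainRegion

  W : Verifier D noOracle
  W = record
    { space = λ n → S.size n (T n)
    ; plen  = certLen
    ; rlen  = λ n → suc (rlen V n + T n * S.B n)
    ; time  = λ n → suc (suc (T n) * S.callCost n)
    ; init  = λ n I₀ → S.encode n (initMem n I₀)
    ; oinit = λ _ _ → tt
    ; tree  = λ n u π → S.compile n (stepTree n u (decode n π))
    ; xpos  = λ n → S.address n (mainCell n (xpos V n))
    ; ypos  = λ n → S.address n (aliveCell {n} {T n})
                      ∷ (map (S.address n) (map (mainCell n) (ypos V n)) ++ S.slotAddresses n {T n})
    }

  stateW : ∀ n → Mem n → State W n
  stateW n M = S.encode n M , tt

  step-W : ∀ n u π (M : Mem n) → stepV W u π (stateW n M) ≡ just (stateW n (S.run n (stepTree n u (decode n π)) M))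
  step-W n u π M = S.exec-compile n n (stepTree n u (decode n π)) M

  run-stepTree-alive : ∀ n u c (M : Mem n) → alive M ≡ true → S.run n (stepTree n u c) M ≡ runSimulation n u c M
  run-stepTree-alive n u c M alive≡ rewrite alive≡ = refl

  run-stepTree-dead : ∀ n u c (M : Mem n) → alive M ≡ false → S.run n (stepTree n u c) M ≡ M
  run-stepTree-dead n u c M dead rewrite dead = refl

  xOut-W : ∀ n (M : Mem n) → xOut W (stateW n M) ≡ lookup (main M) (xpos V n)
  xOut-W n M = S.lookup-encode n M (mainCell n (xpos V n))

  rewardBits : ∀ n → Mem n → Vec Bool (suc (rlen V n + T n * S.B n))
  rewardBits n M = alive M ∷ (map (lookup (main M)) (ypos V n) ++ concat (slots M))

  yOut-W : ∀ n (M : Mem n) → yOut W (stateW n M) ≡ bitsVal (rewardBits n M)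
  yOut-W n M = cong bitsVal (cong₂ _∷_ (S.lookup-encode n M (aliveCell {n} {T n})) (begin
    map (lookup (S.encode n M)) (mainAddresses ++ S.slotAddresses n {T n})
      ≡⟨ map-++ (lookup (S.encode n M)) mainAddresses (S.slotAddresses n {T n}) ⟩
    map (lookup (S.encode n M)) mainAddresses ++ map (lookup (S.encode n M)) (S.slotAddresses n {T n})
      ≡⟨ cong₂ _++_ (trans (S.map-lookup-encode n M (map (mainCell n) (ypos V n)))
                           (sym (map-∘ (S.get n M) (mainCell n) (ypos V n))))
                    (S.map-lookup-slotAddresses n M) ⟩
    map (lookup (main M)) (ypos V n) ++ concat (slots M) ∎))
    where
    open ≡-Reasoning
    mainAddresses : Vec (Fin (S.size n (T n))) (rlen V n)
    mainAddresses = map (S.address n) (map (mainCell n) (ypos V n))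

  SoundInvariant : ∀ n → ℕ → BitString n → Mem n → Set
  SoundInvariant n k I M =
    S.Poisoned n M ⊎ (alive M ≡ true × ∃ λ J → Sound V b k I (main M , J) × S.Tracks n J M)

  soundInvariant-output : ∀ n k I (M : Mem n) → SoundInvariant n k I M → answer D I ≡ b → lookup (main M) (xpos V n) ≡ b
  soundInvariant-output n k I M (inj₁ (_ , poisoned)) _ = poisoned
  soundInvariant-output n k I M (inj₂ (_ , J , sound , _)) = sound-output V k sound

  soundInvariant-step : ∀ n k {I I'} u (M : Mem n) π → upd D I u ≡ just I' → SoundInvariant n (suc k) I M →
    SoundInvariant n k I' (S.run n (stepTree n u (decode n π)) M)
  soundInvariant-step n k u M π eu (inj₁ poisoned@(dead , _)) rewrite run-stepTree-dead n u (decode n π) M dead = inj₁ poisoned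
  soundInvariant-step n k {I' = I'} u M π eu (inj₂ (alive≡ , J , sound , tracks))
    rewrite run-stepTree-alive n u (decode n π) M alive≡ with proj₂ sound u I' eu (proj₁ (decode n π))
  ... | (A' , J') , ex , sound'
    with S.simulate-sound n (tree V n u (proj₁ (decode n π))) (proj₂ (decode n π)) M alive≡ tracks ex
  ...   | inj₁ poisoned = inj₁ poisoned
  ...   | inj₂ (alive' , main≡ , tracks') =
    inj₂ (alive' , J' , subst (λ A → Sound V b k I' (A , J')) (sym main≡) sound' , tracks')

  sound-W : ∀ n k I (M : Mem n) → SoundInvariant n k I M → Sound W b k I (stateW n M)
  sound-W n zero I M inv answer≡ = trans (xOut-W n M) (soundInvariant-output n zero I M inv answer≡)
  sound-W n (suc k) I M inv = (λ answer≡ → trans (xOut-W n M) (soundInvariant-output n (suc k) I M inv answer≡)) ,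
    λ u I' eu π → _ , step-W n u π M ,
      sound-W n k I' (S.run n (stepTree n u (decode n π)) M) (soundInvariant-step n k u M π eu inv)

  CompleteInvariant : ∀ n → ℕ → BitString n → Mem n → Set
  CompleteInvariant n k I M =
    alive M ≡ true × ∃ λ J → Complete V b k I (main M , J) × Sound∞ V b I (main M , J) × S.Faithful n J M

  -- Some proof keeps W alive (faithful-run-exists), hence so does a reward-maximizing one. Among alive runs
  -- the reward of V is compared first and the oracle slots next, so the chosen proof also supplies
  -- reward-maximizing proofs to V, V₁ and V₂.
  module CompletenessStep (depth≤ : ∀ n u π → depth (tree V n u π) ≤ time V n) n {k I I' u} (M : Mem n) {J}
    (eu : upd D I u ≡ just I') (alive≡ : alive M ≡ true) (complete : Complete V b (suc k) I (main M , J))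
    (sound : Sound∞ V b I (main M , J)) (faithful : S.Faithful n J M)
    (π : Vec Bool (certLen n)) (max : Maximizing W u π (stateW n M)) where

    πV : Vec Bool (plen V n)
    πV = proj₁ (decode n π)

    bs : Vec (S.Block n) (T n)
    bs = proj₂ (decode n π)

    R : Certificate n → Mem n
    R c = runSimulation n u c M

    chosen : Mem n
    chosen = R (decode n π)

    ybits : Mem n → Vec Bool (rlen V n)
    ybits X = map (lookup (main X)) (ypos V n)

    step-alive : ∀ π' → stepV W u π' (stateW n M) ≡ just (stateW n (R (decode n π')))
    step-alive π' = trans (step-W n u π' M) (cong (λ X → just (stateW n X)) (run-stepTree-alive n u (decode n π') M alive≡))

    step-encode : ∀ c → stepV W u (encode n c) (stateW n M) ≡ just (stateW n (R c))
    step-encode c = trans (step-alive (encode n c)) (cong (λ c' → just (stateW n (R c'))) (decode-encode n c))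

    reward-≤ : ∀ c → bitsVal (rewardBits n (R c)) ≤ bitsVal (rewardBits n chosen)
    reward-≤ c = subst₂ _≤_ (yOut-W n (R c)) (yOut-W n chosen) (max (encode n c) _ _ (step-alive π) (step-encode c))

    σV : State V n
    σV = proj₁ (sound∞-step V sound eu πV)

    exV : stepV V u πV (main M , J) ≡ just σV
    exV = proj₁ (proj₂ (sound∞-step V sound eu πV))

    alive-chosen : alive chosen ≡ true
    alive-chosen =
      let bs₀ , alive₀ , _ = S.faithful-run-exists n (tree V n u πV) M (depth≤ n u πV) alive≡ faithful exV
          rest = λ X → ybits X ++ concat (slots X)
      in bitsVal-∷-≤-true (alive chosen) (rest chosen) (rest (R (πV , bs₀)))
           (subst (λ a → bitsVal (a ∷ rest (R (πV , bs₀))) ≤ bitsVal (rewardBits n chosen)) alive₀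
             (reward-≤ (πV , bs₀)))

    main-alive : ∀ bs' → alive (R (πV , bs')) ≡ true → main (R (πV , bs')) ≡ proj₁ σV
    main-alive bs' alive' with S.simulate-sound n (tree V n u πV) bs' M alive≡ (proj₁ faithful) exV
    ... | inj₁ (dead , _) with trans (sym alive') dead
    ...   | ()
    main-alive bs' alive' | inj₂ (_ , main≡ , _) = main≡

    ybits-≤ : ∀ X → alive X ≡ true → bitsVal (rewardBits n X) ≤ bitsVal (rewardBits n chosen) →
      bitsVal (ybits X) ≤ bitsVal (ybits chosen)
    ybits-≤ X alive-X ≤chosen rewrite alive-X | alive-chosen =
      bitsVal-++-≤ʳ (true ∷ []) (ybits chosen) (ybits X)
        (bitsVal-++-≤ˡ (true ∷ ybits chosen) (true ∷ ybits X) (concat (slots chosen)) (concat (slots X)) ≤chosen)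

    slots-≤ : ∀ X → alive X ≡ true → ybits X ≡ ybits chosen →
      bitsVal (rewardBits n X) ≤ bitsVal (rewardBits n chosen) → bitsVal (concat (slots X)) ≤ bitsVal (concat (slots chosen))
    slots-≤ X alive-X ybits≡ ≤chosen rewrite alive-X | alive-chosen | ybits≡ =
      bitsVal-++-≤ʳ (true ∷ ybits chosen) (concat (slots chosen)) (concat (slots X)) ≤chosen

    maximizingV : Maximizing V u πV (main M , J)
    maximizingV πV' σa σb exa exb =
      let bs' , alive' , main' , _ = S.faithful-run-exists n (tree V n u πV') M (depth≤ n u πV') alive≡ faithful exb
      in subst₂ (λ X Y → bitsVal (map (lookup X) (ypos V n)) ≤ bitsVal (map (lookup Y) (ypos V n)))
           main' (trans (main-alive bs alive-chosen) (cong proj₁ (just-injective (trans (sym exV) exa))))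
           (ybits-≤ (R (πV' , bs')) alive' (reward-≤ (πV' , bs')))

    slotMaximal : S.SlotMaximal n (λ bs' → R (πV , bs')) bs
    slotMaximal bs' alive' = slots-≤ (R (πV , bs')) alive'
      (cong (λ A → map (lookup A) (ypos V n)) (trans (main-alive bs' alive') (sym (main-alive bs alive-chosen))))
      (reward-≤ (πV , bs'))

    completeInvariant-next : CompleteInvariant n k I' chosen
    completeInvariant-next =
      let main≡ , faithful' =
            S.simulate-maximal n (tree V n u πV) M bs (depth≤ n u πV) alive≡ faithful exV alive-chosen slotMaximal
      in alive-chosen , proj₂ σV ,
         subst (λ A → Complete V b k I' (A , proj₂ σV)) (sym main≡) (proj₂ complete _ I' eu πV maximizingV σV exV) ,
         subst (λ A → Sound∞ V b I' (A , proj₂ σV)) (sym main≡) (proj₂ (proj₂ (sound∞-step V sound eu πV))) ,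
         faithful'

  complete-W : (∀ n u π → depth (tree V n u π) ≤ time V n) →
    ∀ n k I (M : Mem n) → CompleteInvariant n k I M → Complete W b k I (stateW n M)
  complete-W depth≤ n zero I M (_ , J , complete , _) answer≡ =
    trans (xOut-W n M) (complete-output V {σ = main M , J} zero complete answer≡)
  complete-W depth≤ n (suc k) I M (alive≡ , J , complete , sound , faithful) =
    (λ answer≡ → trans (xOut-W n M) (complete-output V {σ = main M , J} (suc k) complete answer≡)) , next
    where
    next : ∀ u I' → upd D I u ≡ just I' → ∀ π → Maximizing W u π (stateW n M) →
      ∀ σ' → stepV W u π (stateW n M) ≡ just σ' → Complete W b k I' σ'
    next u I' eu π max σ' step≡ =
      subst (Complete W b k I') (just-injective (trans (sym (C.step-alive π)) step≡))
        (complete-W depth≤ n k I' C.chosen C.completeInvariant-next)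
      where module C = CompletenessStep depth≤ n M eu alive≡ complete sound faithful π max

  bounds-W : ValidVerifier V b → ValidVerifier V₁ false → ValidVerifier V₂ true → Poly m →
    PolyLog (time W) × Poly (space W) × PolyLog (plen W) × PolyLog (rlen W)
  bounds-W (time≤ , space≤ , plen≤ , rlen≤ , _) (time₁≤ , space₁≤ , plen₁≤ , rlen₁≤ , _)
           (time₂≤ , space₂≤ , plen₂≤ , rlen₂≤ , _) m≤ =
    bounded-suc (λ n → suc (T n) * S.callCost n)
      (bounded-* (λ n → suc (T n)) (λ n → S.callCost n) (bounded-suc T time≤) callCost≤) ,
    bounded-+ (space V) (λ n → space V₁ (m n) + (space V₂ (m n) + suc (T n * S.B n))) space≤
      (bounded-+ (λ n → space V₁ (m n)) (λ n → space V₂ (m n) + suc (T n * S.B n)) (poly-∘ space₁≤ m≤)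
        (bounded-+ (λ n → space V₂ (m n)) (λ n → suc (T n * S.B n)) (poly-∘ space₂≤ m≤)
          (polyLog⇒poly (bounded-suc (λ n → T n * S.B n) slotsLen≤)))) ,
    bounded-+ (plen V) (λ n → T n * (plen V₁ (m n) + plen V₂ (m n))) plen≤
      (bounded-* T (λ n → plen V₁ (m n) + plen V₂ (m n)) time≤
        (bounded-+ (λ n → plen V₁ (m n)) (λ n → plen V₂ (m n))
          (polyLog-∘-poly plen₁≤ m≤) (polyLog-∘-poly plen₂≤ m≤))) ,
    bounded-suc (λ n → rlen V n + T n * S.B n) (bounded-+ (rlen V) (λ n → T n * S.B n) rlen≤ slotsLen≤)
    where
    B≤ : PolyLog (λ n → S.B n)
    B≤ = bounded-+ (λ n → rlen V₁ (m n)) (λ n → rlen V₂ (m n))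
      (polyLog-∘-poly rlen₁≤ m≤) (polyLog-∘-poly rlen₂≤ m≤)
    callCost≤ : PolyLog (λ n → S.callCost n)
    callCost≤ = bounded-+ (λ n → time V₁ (m n) + time V₂ (m n) + S.B n * 2) (λ _ → 2)
      (bounded-+ (λ n → time V₁ (m n) + time V₂ (m n)) (λ n → S.B n * 2)
        (bounded-+ (λ n → time V₁ (m n)) (λ n → time V₂ (m n))
          (polyLog-∘-poly time₁≤ m≤) (polyLog-∘-poly time₂≤ m≤))
        (bounded-* (λ n → S.B n) (λ _ → 2) B≤ (bounded-const 2)))
      (bounded-const 2)
    slotsLen≤ : PolyLog (λ n → T n * S.B n)
    slotsLen≤ = bounded-* T (λ n → S.B n) time≤ B≤

  depth-W : (∀ n u π → depth (tree V n u π) ≤ time V n) → (∀ N v π → depth (tree V₁ N v π) ≤ time V₁ N) →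
    (∀ N v π → depth (tree V₂ N v π) ≤ time V₂ N) → ∀ n u π → depth (tree W n u π) ≤ time W n
  depth-W depth≤ depth₁≤ depth₂≤ n u π = let πV , bs = decode n π in begin
    depth (S.compile n (stepTree n u (πV , bs)))
      ≡⟨ S.depth-compile n (stepTree n u (πV , bs)) ⟩
    suc (cellDepth (S.simulate n (tree V n u πV) bs))
      ≤⟨ s≤s (S.cellDepth-simulate n (depth₁≤ (m n)) (depth₂≤ (m n)) (tree V n u πV) bs) ⟩
    suc (suc (depth (tree V n u πV)) * S.callCost n)
      ≤⟨ s≤s (*-monoˡ-≤ (S.callCost n) (s≤s (depth≤ n u πV))) ⟩
    suc (suc (T n) * S.callCost n) ∎
    where open ≤-Reasoning

  valid-W : ValidVerifier V b → ValidVerifier V₁ false → ValidVerifier V₂ true → Poly m → ValidVerifier W b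
  valid-W valid@(_ , _ , _ , _ , depth≤ , correct) valid₁@(_ , _ , _ , _ , depth₁≤ , correct₁)
          valid₂@(_ , _ , _ , _ , depth₂≤ , correct₂) m≤ =
    let time≤ , space≤ , plen≤ , rlen≤ = bounds-W valid valid₁ valid₂ m≤
    in time≤ , space≤ , plen≤ , rlen≤ , depth-W depth≤ depth₁≤ depth₂≤ ,
       λ n I₀ k → sound-W n k I₀ (initMem n I₀) (soundInvariant₀ n I₀ k) ,
                  complete-W depth≤ n k I₀ (initMem n I₀) (completeInvariant₀ n I₀ k)
    where
    sound₁ : ∀ n I₀ → S.Sound₁ n (oinit V n I₀) (init V₁ (m n) (oinit V n I₀))
    sound₁ n I₀ k = proj₁ (correct₁ (m n) (oinit V n I₀) k)
    sound₂ : ∀ n I₀ → S.Sound₂ n (oinit V n I₀) (init V₂ (m n) (oinit V n I₀))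
    sound₂ n I₀ k = proj₁ (correct₂ (m n) (oinit V n I₀) k)
    soundInvariant₀ : ∀ n I₀ k → SoundInvariant n k I₀ (initMem n I₀)
    soundInvariant₀ n I₀ k = inj₂ (refl , oinit V n I₀ , proj₁ (correct n I₀ k) , sound₁ n I₀ , sound₂ n I₀)
    completeInvariant₀ : ∀ n I₀ k → CompleteInvariant n k I₀ (initMem n I₀)
    completeInvariant₀ n I₀ k = refl , oinit V n I₀ , proj₂ (correct n I₀ k) , (λ k' → proj₁ (correct n I₀ k')) ,
      (sound₁ n I₀ , sound₂ n I₀) ,
      (λ k' → proj₂ (correct₁ (m n) (oinit V n I₀) k')) , (λ k' → proj₂ (correct₂ (m n) (oinit V n I₀) k'))

collapse : ∀ b → VClassWith b (NPdy ∩ coNPdy) ⊆ VClass b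
collapse b D (D' , ((V₁ , valid₁) , (V₂ , valid₂)) , m , m≤ , V , valid) =
  Collapse.W D D' m b V V₁ V₂ , Collapse.valid-W D D' m b V V₁ V₂ valid valid₁ valid₂ m≤

-- The collapse

module _ (NP⊆coNP : NPdy ⊆ coNPdy) where

  coNP⊆NP : coNPdy ⊆ NPdy
  coNP⊆NP D D∈coNP = negate true (complement D) (answer D) (λ I → sym (not-involutive (answer D I)))
    (NP⊆coNP (complement D) (negate true D (λ I → not (answer D I)) (λ _ → refl) D∈coNP))

  Σ⊆NP∩coNP : ∀ i → SigmaH i ⊆ (NPdy ∩ coNPdy)
  Σ⊆NP∩coNP zero D D∈NP = D∈NP , NP⊆coNP D D∈NP
  Σ⊆NP∩coNP (suc i) D (D' , D'∈Σ , oracle) =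
    let D∈NP = collapse false D (D' , Σ⊆NP∩coNP i D' D'∈Σ , oracle) in D∈NP , NP⊆coNP D D∈NP

  Π⊆NP∩coNP : ∀ i → PiH i ⊆ (NPdy ∩ coNPdy)
  Π⊆NP∩coNP zero D D∈coNP = coNP⊆NP D D∈coNP , D∈coNP
  Π⊆NP∩coNP (suc i) D (D' , D'∈Σ , oracle) =
    let D∈coNP = collapse true D (D' , Σ⊆NP∩coNP i D' D'∈Σ , oracle) in coNP⊆NP D D∈coNP , D∈coNP

mainTheorem4 : NPdy ⊆ coNPdy → PHdy ≐ (NPdy ∩ coNPdy)
mainTheorem4 NP⊆coNP = PH⊆ , λ D D∈NP∩coNP → 0 , inj₁ (proj₁ D∈NP∩coNP)
  where
  PH⊆ : PHdy ⊆ (NPdy ∩ coNPdy)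
  PH⊆ D (i , inj₁ D∈Σ) = Σ⊆NP∩coNP NP⊆coNP i D D∈Σ
  PH⊆ D (i , inj₂ D∈Π) = Π⊆NP∩coNP NP⊆coNP i D D∈Π
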